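{- A $\Delta_0$ formula provable in the base calculus for $\Delta_0$ formulas is also provable in the $\mathrm{EL}$-normalized calculus for $\Delta_0$ formulas.
   Context: $\Delta_0$ formulas over types $T::=\mathsf{Ur}\mid T\times U\mid\mathsf{Unit}\mid\mathsf{Set}(T)$: typed terms from variables by $\langle\rangle$, pairing, $\pi_1,\pi_2$; formulas from $t=_{\mathsf{Ur}}u$, $t\neq_{\mathsf{Ur}}u$ (atomic), $\top,\bot,\wedge,\vee$, $\forall x\in t\,\varphi$, $\exists x\in t\,\varphi$. A formula $\varphi$ is provable in a calculus if $\emptyset\vdash\varphi$ is derivable. The $\mathrm{EL}$-normalized calculus has sequents $\Theta\vdash\Delta$ ($\Theta$ a finite multiset of membership atoms $t\in u$, $\Delta$ a finite multiset of $\Delta_0$ formulas); $\Delta^{\mathrm{EL}}$ denotes a multiset containing only atomic formulas, formulas whose top connective is $\exists$, and $\bot$. Rules: axioms $\Theta\vdash x=_{\mathsf{Ur}}x,\Delta$ and $\Theta\vdash\top,\Delta$; ($\neq$) from $\Theta\vdash t\neq_{\mathsf{Ur}}u,\alpha[u/x],\alpha[t/x],\Delta^{\mathrm{EL}}$ infer $\Theta\vdash t\neq_{\mathsf{Ur}}u,\alpha[t/x],\Delta^{\mathrm{EL}}$ ($\alpha$ atomic); ($\wedge$) from $\Theta\vdash\varphi_1,\Delta$ and $\Theta\vdash\varphi_2,\Delta$ infer $\Theta\vdash\varphi_1\wedge\varphi_2,\Delta$; ($\vee$) from $\Theta\vdash\varphi_1,\varphi_2,\Delta$ infer $\Theta\vdash\varphi_1\vee\varphi_2,\Delta$;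 ($\forall$) from $\Theta,y\in b\vdash\varphi[y/x],\Delta$ infer $\Theta\vdash\forall x\in b\,\varphi,\Delta$ ($y$ fresh); ($\exists$) from $\Theta,t\in b\vdash\varphi[t/x],\exists x\in b\,\varphi,\Delta^{\mathrm{EL}}$ infer $\Theta,t\in b\vdash\exists x\in b\,\varphi,\Delta^{\mathrm{EL}}$, where $t$ is a tuple-term (built from variables by pairing); ($\times_\eta$) from $\Theta[\langle x_1,x_2\rangle/x]\vdash\Delta^{\mathrm{EL}}[\langle x_1,x_2\rangle/x]$ infer $\Theta\vdash\Delta^{\mathrm{EL}}$ ($x_1,x_2$ fresh); ($\times_\beta$) from $\Theta[t_i/x]\vdash\Delta^{\mathrm{EL}}[t_i/x]$ infer $\Theta[\pi_i(\langle t_1,t_2\rangle)/x]\vdash\Delta^{\mathrm{EL}}[\pi_i(\langle t_1,t_2\rangle)/x]$ ($i\in\{1,2\}$). The base calculus is obtained from the $\mathrm{EL}$-normalized calculus by dropping all $\mathrm{EL}$ requirements on the sequents and dropping the requirement in the $\exists$ rule that $t$ is a tuple-term. -}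

module Defs where

open import Data.Nat using (ℕ) renaming (_≟_ to _≟ℕ_)
open import Data.List using (List; []; _∷_; _++_; map)
open import Data.List.Relation.Unary.All using (All)
open import Data.List.Membership.Propositional using (_∉_)
open import Data.List.Relation.Binary.Permutation.Propositional using (_↭_)
open import Data.Product using (_×_; _,_)
open import Relation.Binary.PropositionalEquality using (_≡_; _≢_; refl)
open import Relation.Nullary using (Dec; yes; no)

infixr 6 _⊗_
data Ty : Set where
  Ur Unit : Ty
  _⊗_     : Ty → Ty → Ty
  SetT    : Ty → Ty

_≟Ty_ : (a b : Ty) → Dec (a ≡ b)
Ur ≟Ty Ur = yes refl
Unit ≟Ty Unit = yes refl
(a ⊗ b) ≟Ty (c ⊗ d) with a ≟Ty c | b ≟Ty d
... | yes refl | yes refl = yes refl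
... | no p | _ = no λ { refl → p refl }
... | yes _ | no q = no λ { refl → q refl }
SetT a ≟Ty SetT b with a ≟Ty b
... | yes refl = yes refl
... | no p = no λ { refl → p refl }
Ur ≟Ty Unit = no λ ()
Ur ≟Ty (_ ⊗ _) = no λ ()
Ur ≟Ty SetT _ = no λ ()
Unit ≟Ty Ur = no λ ()
Unit ≟Ty (_ ⊗ _) = no λ ()
Unit ≟Ty SetT _ = no λ ()
(_ ⊗ _) ≟Ty Ur = no λ ()
(_ ⊗ _) ≟Ty Unit = no λ ()
(_ ⊗ _) ≟Ty SetT _ = no λ ()
SetT _ ≟Ty Ur = no λ ()
SetT _ ≟Ty Unit = no λ ()
SetT _ ≟Ty (_ ⊗ _) = no λ ()

-- Locally nameless syntax: free variables are named (a name n : ℕ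
-- together with its type T, so the variable is the pair (n , T));
-- bound variables are typed de Bruijn indices into a context Γ.

Ctx : Set
Ctx = List Ty

data _∋_ : Ctx → Ty → Set where
  here  : ∀ {Γ T} → (T ∷ Γ) ∋ T
  there : ∀ {Γ T S} → Γ ∋ T → (S ∷ Γ) ∋ T

data Tm (Γ : Ctx) : Ty → Set where
  fv    : ∀ {T} → ℕ → Tm Γ T
  bv    : ∀ {T} → Γ ∋ T → Tm Γ T
  ⟨⟩    : Tm Γ Unit
  ⟨_,_⟩ : ∀ {A B} → Tm Γ A → Tm Γ B → Tm Γ (A ⊗ B)
  π₁    : ∀ {A B} → Tm Γ (A ⊗ B) → Tm Γ A
  π₂    : ∀ {A B} → Tm Γ (A ⊗ B) → Tm Γ B

infix 7 _=U_ _≠U_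
infixr 6 _∧F_
infixr 5 _∨F_
data Fm (Γ : Ctx) : Set where
  _=U_ _≠U_ : Tm Γ Ur → Tm Γ Ur → Fm Γ
  ⊤F ⊥F     : Fm Γ
  _∧F_ _∨F_ : Fm Γ → Fm Γ → Fm Γ
  -- ∀F b φ  is  ∀ x ∈ b φ ;  ∃F b φ  is  ∃ x ∈ b φ  (x = de Bruijn index 0)
  ∀F ∃F     : ∀ {T} → Tm Γ (SetT T) → Fm (T ∷ Γ) → Fm Γ

Ren : Ctx → Ctx → Set
Ren Γ Δ = ∀ {T} → Γ ∋ T → Δ ∋ T

extR : ∀ {Γ Δ S} → Ren Γ Δ → Ren (S ∷ Γ) (S ∷ Δ)
extR ρ here = here
extR ρ (there x) = there (ρ x)

renTm : ∀ {Γ Δ T} → Ren Γ Δ → Tm Γ T → Tm Δ T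
renTm ρ (fv n) = fv n
renTm ρ (bv x) = bv (ρ x)
renTm ρ ⟨⟩ = ⟨⟩
renTm ρ ⟨ a , b ⟩ = ⟨ renTm ρ a , renTm ρ b ⟩
renTm ρ (π₁ a) = π₁ (renTm ρ a)
renTm ρ (π₂ a) = π₂ (renTm ρ a)

Sub : Ctx → Ctx → Set
Sub Γ Δ = ∀ {T} → Γ ∋ T → Tm Δ T

extS : ∀ {Γ Δ S} → Sub Γ Δ → Sub (S ∷ Γ) (S ∷ Δ)
extS σ here = bv here
extS σ (there x) = renTm there (σ x)

subTm : ∀ {Γ Δ T} → Sub Γ Δ → Tm Γ T → Tm Δ T
subTm σ (fv n) = fv n
subTm σ (bv x) = σ x
subTm σ ⟨⟩ = ⟨⟩
subTm σ ⟨ a , b ⟩ = ⟨ subTm σ a , subTm σ b ⟩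
subTm σ (π₁ a) = π₁ (subTm σ a)
subTm σ (π₂ a) = π₂ (subTm σ a)

subFm : ∀ {Γ Δ} → Sub Γ Δ → Fm Γ → Fm Δ
subFm σ (a =U b) = subTm σ a =U subTm σ b
subFm σ (a ≠U b) = subTm σ a ≠U subTm σ b
subFm σ ⊤F = ⊤F
subFm σ ⊥F = ⊥F
subFm σ (φ ∧F ψ) = subFm σ φ ∧F subFm σ ψ
subFm σ (φ ∨F ψ) = subFm σ φ ∨F subFm σ ψ
subFm σ (∀F b φ) = ∀F (subTm σ b) (subFm (extS σ) φ)
subFm σ (∃F b φ) = ∃F (subTm σ b) (subFm (extS σ) φ)

sub₀ : ∀ {T} → Tm [] T → Sub (T ∷ []) []
sub₀ t here = t
sub₀ t (there ())

inst : ∀ {T} → Fm (T ∷ []) → Tm [] T → Fm []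
inst φ t = subFm (sub₀ t) φ

noVar : ∀ {Γ T} → [] ∋ T → Γ ∋ T
noVar ()

wk : ∀ {Γ T} → Tm [] T → Tm Γ T
wk = renTm noVar

FSub : Set
FSub = ∀ {T} → ℕ → Tm [] T

fsubTm : ∀ {Γ T} → FSub → Tm Γ T → Tm Γ T
fsubTm ρ (fv n) = wk (ρ n)
fsubTm ρ (bv x) = bv x
fsubTm ρ ⟨⟩ = ⟨⟩
fsubTm ρ ⟨ a , b ⟩ = ⟨ fsubTm ρ a , fsubTm ρ b ⟩
fsubTm ρ (π₁ a) = π₁ (fsubTm ρ a)
fsubTm ρ (π₂ a) = π₂ (fsubTm ρ a)

fsubFm : ∀ {Γ} → FSub → Fm Γ → Fm Γ
fsubFm ρ (a =U b) = fsubTm ρ a =U fsubTm ρ b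
fsubFm ρ (a ≠U b) = fsubTm ρ a ≠U fsubTm ρ b
fsubFm ρ ⊤F = ⊤F
fsubFm ρ ⊥F = ⊥F
fsubFm ρ (φ ∧F ψ) = fsubFm ρ φ ∧F fsubFm ρ ψ
fsubFm ρ (φ ∨F ψ) = fsubFm ρ φ ∨F fsubFm ρ ψ
fsubFm ρ (∀F b φ) = ∀F (fsubTm ρ b) (fsubFm ρ φ)
fsubFm ρ (∃F b φ) = ∃F (fsubTm ρ b) (fsubFm ρ φ)

single : ∀ {T} → Tm [] T → ℕ → FSub
single {T} s n {T'} m with m ≟ℕ n | T' ≟Ty T
... | yes refl | yes refl = s
... | _ | _ = fv m

-- Sequents: Θ is a (multi)set of membership atoms t ∈ u, Δ of formulas.

infix 6 _∈M_
data Mem : Set where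
  _∈M_ : ∀ {T} → Tm [] T → Tm [] (SetT T) → Mem

fsubMem : FSub → Mem → Mem
fsubMem ρ (a ∈M b) = fsubTm ρ a ∈M fsubTm ρ b

_[_/_]F : ∀ {T} → Fm [] → Tm [] T → ℕ → Fm []
φ [ s / n ]F = fsubFm (single s n) φ

_[_/_]Θ : ∀ {T} → List Mem → Tm [] T → ℕ → List Mem
Θ [ s / n ]Θ = map (fsubMem (single s n)) Θ

_[_/_]Δ : ∀ {T} → List (Fm []) → Tm [] T → ℕ → List (Fm [])
Δ [ s / n ]Δ = map (fsubFm (single s n)) Δ

Var : Set
Var = ℕ × Ty

fvsTm : ∀ {Γ T} → Tm Γ T → List Var
fvsTm (fv {T} n) = (n , T) ∷ []
fvsTm (bv x) = []
fvsTm ⟨⟩ = []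
fvsTm ⟨ a , b ⟩ = fvsTm a ++ fvsTm b
fvsTm (π₁ a) = fvsTm a
fvsTm (π₂ a) = fvsTm a

fvsFm : ∀ {Γ} → Fm Γ → List Var
fvsFm (a =U b) = fvsTm a ++ fvsTm b
fvsFm (a ≠U b) = fvsTm a ++ fvsTm b
fvsFm ⊤F = []
fvsFm ⊥F = []
fvsFm (φ ∧F ψ) = fvsFm φ ++ fvsFm ψ
fvsFm (φ ∨F ψ) = fvsFm φ ++ fvsFm ψ
fvsFm (∀F b φ) = fvsTm b ++ fvsFm φ
fvsFm (∃F b φ) = fvsTm b ++ fvsFm φ

fvsΘ : List Mem → List Var
fvsΘ [] = []
fvsΘ ((a ∈M b) ∷ Θ) = fvsTm a ++ fvsTm b ++ fvsΘ Θ

fvsΔ : List (Fm []) → List Var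
fvsΔ [] = []
fvsΔ (φ ∷ Δ) = fvsFm φ ++ fvsΔ Δ

FreshIn : Var → List Mem → List (Fm []) → Set
FreshIn v Θ Δ = v ∉ (fvsΘ Θ ++ fvsΔ Δ)

data IsAtomic : Fm [] → Set where
  at-eq  : ∀ {a b} → IsAtomic (a =U b)
  at-neq : ∀ {a b} → IsAtomic (a ≠U b)

data IsEL : Fm [] → Set where
  el-eq  : ∀ {a b} → IsEL (a =U b)
  el-neq : ∀ {a b} → IsEL (a ≠U b)
  el-∃   : ∀ {T} {b : Tm [] (SetT T)} {φ} → IsEL (∃F b φ)
  el-⊥   : IsEL ⊥F

EL : List (Fm []) → Set
EL Δ = All IsEL Δ

data IsTuple : ∀ {T} → Tm [] T → Set where
  tup-var  : ∀ {T} {n : ℕ} → IsTuple (fv {T = T} n)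
  tup-pair : ∀ {A B} {a : Tm [] A} {b : Tm [] B} →
             IsTuple a → IsTuple b → IsTuple ⟨ a , b ⟩

-- Base calculus.  Multisets are represented by lists, with a rule
-- identifying sequents up to permutation of Θ and Δ; principal
-- formulas/atoms are written at the head.

infix 4 _⊢B_ _⊢E_
data _⊢B_ : List Mem → List (Fm []) → Set where
  permB : ∀ {Θ Θ' Δ Δ'} → Θ ↭ Θ' → Δ ↭ Δ' → Θ ⊢B Δ → Θ' ⊢B Δ'
  axEqB : ∀ {Θ Δ} (n : ℕ) → Θ ⊢B (fv n =U fv n) ∷ Δ
  axTopB : ∀ {Θ Δ} → Θ ⊢B ⊤F ∷ Δ
  neqB : ∀ {Θ Δ} {t u : Tm [] Ur} {α : Fm []} (n : ℕ) → IsAtomic α →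
         Θ ⊢B (t ≠U u) ∷ (α [ u / n ]F) ∷ (α [ t / n ]F) ∷ Δ →
         Θ ⊢B (t ≠U u) ∷ (α [ t / n ]F) ∷ Δ
  andB : ∀ {Θ Δ φ₁ φ₂} → Θ ⊢B φ₁ ∷ Δ → Θ ⊢B φ₂ ∷ Δ → Θ ⊢B (φ₁ ∧F φ₂) ∷ Δ
  orB  : ∀ {Θ Δ φ₁ φ₂} → Θ ⊢B φ₁ ∷ φ₂ ∷ Δ → Θ ⊢B (φ₁ ∨F φ₂) ∷ Δ
  allB : ∀ {Θ Δ T} {b : Tm [] (SetT T)} {φ : Fm (T ∷ [])} (y : ℕ) →
         FreshIn (y , T) Θ (∀F b φ ∷ Δ) →
         (fv y ∈M b) ∷ Θ ⊢B inst φ (fv y) ∷ Δ →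
         Θ ⊢B ∀F b φ ∷ Δ
  exB  : ∀ {Θ Δ T} {b : Tm [] (SetT T)} {φ : Fm (T ∷ [])} (t : Tm [] T) →
         (t ∈M b) ∷ Θ ⊢B inst φ t ∷ ∃F b φ ∷ Δ →
         (t ∈M b) ∷ Θ ⊢B ∃F b φ ∷ Δ
  etaB : ∀ {Θ Δ A B} (x x₁ x₂ : ℕ) →
         FreshIn (x₁ , A) Θ Δ → FreshIn (x₂ , B) Θ Δ → (x₁ , A) ≢ (x₂ , B) →
         Θ [ ⟨ fv {T = A} x₁ , fv {T = B} x₂ ⟩ / x ]Θ ⊢B Δ [ ⟨ fv {T = A} x₁ , fv {T = B} x₂ ⟩ / x ]Δ →
         Θ ⊢B Δ
  beta₁B : ∀ {Θ Δ A B} (x : ℕ) (t₁ : Tm [] A) (t₂ : Tm [] B) →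
         Θ [ t₁ / x ]Θ ⊢B Δ [ t₁ / x ]Δ →
         Θ [ π₁ ⟨ t₁ , t₂ ⟩ / x ]Θ ⊢B Δ [ π₁ ⟨ t₁ , t₂ ⟩ / x ]Δ
  beta₂B : ∀ {Θ Δ A B} (x : ℕ) (t₁ : Tm [] A) (t₂ : Tm [] B) →
         Θ [ t₂ / x ]Θ ⊢B Δ [ t₂ / x ]Δ →
         Θ [ π₂ ⟨ t₁ , t₂ ⟩ / x ]Θ ⊢B Δ [ π₂ ⟨ t₁ , t₂ ⟩ / x ]Δ

data _⊢E_ : List Mem → List (Fm []) → Set where
  permE : ∀ {Θ Θ' Δ Δ'} → Θ ↭ Θ' → Δ ↭ Δ' → Θ ⊢E Δ → Θ' ⊢E Δ'
  axEqE : ∀ {Θ Δ} (n : ℕ) → Θ ⊢E (fv n =U fv n) ∷ Δ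
  axTopE : ∀ {Θ Δ} → Θ ⊢E ⊤F ∷ Δ
  neqE : ∀ {Θ Δ} {t u : Tm [] Ur} {α : Fm []} (n : ℕ) → IsAtomic α → EL Δ →
         Θ ⊢E (t ≠U u) ∷ (α [ u / n ]F) ∷ (α [ t / n ]F) ∷ Δ →
         Θ ⊢E (t ≠U u) ∷ (α [ t / n ]F) ∷ Δ
  andE : ∀ {Θ Δ φ₁ φ₂} → Θ ⊢E φ₁ ∷ Δ → Θ ⊢E φ₂ ∷ Δ → Θ ⊢E (φ₁ ∧F φ₂) ∷ Δ
  orE  : ∀ {Θ Δ φ₁ φ₂} → Θ ⊢E φ₁ ∷ φ₂ ∷ Δ → Θ ⊢E (φ₁ ∨F φ₂) ∷ Δ
  allE : ∀ {Θ Δ T} {b : Tm [] (SetT T)} {φ : Fm (T ∷ [])} (y : ℕ) →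
         FreshIn (y , T) Θ (∀F b φ ∷ Δ) →
         (fv y ∈M b) ∷ Θ ⊢E inst φ (fv y) ∷ Δ →
         Θ ⊢E ∀F b φ ∷ Δ
  exE  : ∀ {Θ Δ T} {b : Tm [] (SetT T)} {φ : Fm (T ∷ [])} (t : Tm [] T) →
         IsTuple t → EL Δ →
         (t ∈M b) ∷ Θ ⊢E inst φ t ∷ ∃F b φ ∷ Δ →
         (t ∈M b) ∷ Θ ⊢E ∃F b φ ∷ Δ
  etaE : ∀ {Θ Δ A B} (x x₁ x₂ : ℕ) → EL Δ →
         FreshIn (x₁ , A) Θ Δ → FreshIn (x₂ , B) Θ Δ → (x₁ , A) ≢ (x₂ , B) →
         Θ [ ⟨ fv {T = A} x₁ , fv {T = B} x₂ ⟩ / x ]Θ ⊢E Δ [ ⟨ fv {T = A} x₁ , fv {T = B} x₂ ⟩ / x ]Δ →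
         Θ ⊢E Δ
  beta₁E : ∀ {Θ Δ A B} (x : ℕ) (t₁ : Tm [] A) (t₂ : Tm [] B) → EL Δ →
         Θ [ t₁ / x ]Θ ⊢E Δ [ t₁ / x ]Δ →
         Θ [ π₁ ⟨ t₁ , t₂ ⟩ / x ]Θ ⊢E Δ [ π₁ ⟨ t₁ , t₂ ⟩ / x ]Δ
  beta₂E : ∀ {Θ Δ A B} (x : ℕ) (t₁ : Tm [] A) (t₂ : Tm [] B) → EL Δ →
         Θ [ t₂ / x ]Θ ⊢E Δ [ t₂ / x ]Δ →
         Θ [ π₂ ⟨ t₁ , t₂ ⟩ / x ]Θ ⊢E Δ [ π₂ ⟨ t₁ , t₂ ⟩ / x ]Δ

ProvableB : Fm [] → Set
ProvableB φ = [] ⊢B φ ∷ []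

ProvableE : Fm [] → Set
ProvableE φ = [] ⊢E φ ∷ []

module Submission where

-- The rules ≠, ∃, η, β₁ and β₂ remain
-- admissible without their EL side condition: the rules for ∧, ∨ and ∀ are invertible in the
-- EL-normalized calculus, so the non-EL formulas of the side context can be decomposed until
-- it is EL, the restricted rule applied, and the decomposition rebuilt.  Invertibility of ∀,
-- and commuting β with the decomposition, use that EL-normalized derivations are closed under
-- substituting tuple-terms for variables.  The tuple-term demanded by the restricted ∃ rule
-- exists because in a base derivation of ⊢ φ every membership atom t ∈ u has a tuple-term t:
-- this passes from conclusions to premises, as ∀ adds a variable, η substitutes a pair of
-- variables, and the projection substituted by β cannot occur inside a tuple-term.

open import Defs
open import Data.Empty using (⊥; ⊥-elim)
open import Data.List using (List; []; _∷_; _++_; map)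
open import Data.List.Membership.Propositional using (_∈_; _∉_)
open import Data.List.Membership.Propositional.Properties using (∈-++⁺ˡ; ∈-++⁺ʳ; ∈-++⁻; ∈-∃++)
open import Data.List.Properties using (map-∘; map-cong; map-id; ++-assoc)
open import Data.List.Relation.Binary.Subset.Propositional using (_⊆_)
open import Data.List.Relation.Binary.Subset.Propositional.Properties using (⊆-refl; ⊆-reflexive; xs⊆xs++ys; xs⊆ys++xs; ++⁺; ++⁺ʳ; ∷⁺ʳ)
open import Data.List.Relation.Unary.Any using (here; there)
open import Data.List.Relation.Unary.All using (All; []; _∷_)
import Data.List.Relation.Unary.All as All
import Data.List.Relation.Unary.All.Properties as AllP
open import Data.List.Relation.Binary.Permutation.Propositional using (_↭_; ↭-refl; ↭-sym; ↭-trans; prep; swap)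
import Data.List.Relation.Binary.Permutation.Propositional.Properties as PermP
open import Data.Nat using (ℕ; suc; _+_; _≤_; _⊔_; s≤s) renaming (_≟_ to _≟ℕ_)
open import Data.Nat.Properties using (m≤m⊔n; m≤n⊔m; ≤-refl; ≤-trans; 1+n≰n; m≤m+n; m≤n+m; +-monoˡ-≤; +-assoc)
open import Data.Product using (Σ; ∃; ∃-syntax; _×_; _,_; proj₁; proj₂)
open import Data.Sum using (_⊎_; inj₁; inj₂; [_,_]′; map₁; map₂)
open import Function using (_∘_)
open import Relation.Binary.PropositionalEquality
open import Relation.Nullary using (Dec; yes; no; ¬_)

wk-id : ∀ {T} (a : Tm [] T) → wk a ≡ a
wk-id (fv n) = refl
wk-id (bv ())
wk-id ⟨⟩ = refl
wk-id ⟨ a , b ⟩ = cong₂ ⟨_,_⟩ (wk-id a) (wk-id b)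
wk-id (π₁ a) = cong π₁ (wk-id a)
wk-id (π₂ a) = cong π₂ (wk-id a)

renTm-wk : ∀ {Γ Δ T} (r : Ren Γ Δ) (a : Tm [] T) → renTm r (wk a) ≡ wk a
renTm-wk r (fv n) = refl
renTm-wk r (bv ())
renTm-wk r ⟨⟩ = refl
renTm-wk r ⟨ a , b ⟩ = cong₂ ⟨_,_⟩ (renTm-wk r a) (renTm-wk r b)
renTm-wk r (π₁ a) = cong π₁ (renTm-wk r a)
renTm-wk r (π₂ a) = cong π₂ (renTm-wk r a)

subTm-wk : ∀ {Γ Δ T} (σ : Sub Γ Δ) (a : Tm [] T) → subTm σ (wk a) ≡ wk a
subTm-wk σ (fv n) = refl
subTm-wk σ (bv ())
subTm-wk σ ⟨⟩ = refl
subTm-wk σ ⟨ a , b ⟩ = cong₂ ⟨_,_⟩ (subTm-wk σ a) (subTm-wk σ b)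
subTm-wk σ (π₁ a) = cong π₁ (subTm-wk σ a)
subTm-wk σ (π₂ a) = cong π₂ (subTm-wk σ a)

fsubTm-renTm : ∀ {Γ Δ T} (ρ : FSub) (r : Ren Γ Δ) (a : Tm Γ T) →
               fsubTm ρ (renTm r a) ≡ renTm r (fsubTm ρ a)
fsubTm-renTm ρ r (fv n) = sym (renTm-wk r (ρ n))
fsubTm-renTm ρ r (bv x) = refl
fsubTm-renTm ρ r ⟨⟩ = refl
fsubTm-renTm ρ r ⟨ a , b ⟩ = cong₂ ⟨_,_⟩ (fsubTm-renTm ρ r a) (fsubTm-renTm ρ r b)
fsubTm-renTm ρ r (π₁ a) = cong π₁ (fsubTm-renTm ρ r a)
fsubTm-renTm ρ r (π₂ a) = cong π₂ (fsubTm-renTm ρ r a)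

infixl 5 _⨾_
_⨾_ : FSub → FSub → FSub
(ρ₁ ⨾ ρ₂) n = fsubTm ρ₂ (ρ₁ n)

fsubTm-⨾ : ∀ {Γ T} (ρ₁ ρ₂ : FSub) (a : Tm Γ T) → fsubTm ρ₂ (fsubTm ρ₁ a) ≡ fsubTm (ρ₁ ⨾ ρ₂) a
fsubTm-⨾ ρ₁ ρ₂ (fv n) = fsubTm-renTm ρ₂ noVar (ρ₁ n)
fsubTm-⨾ ρ₁ ρ₂ (bv x) = refl
fsubTm-⨾ ρ₁ ρ₂ ⟨⟩ = refl
fsubTm-⨾ ρ₁ ρ₂ ⟨ a , b ⟩ = cong₂ ⟨_,_⟩ (fsubTm-⨾ ρ₁ ρ₂ a) (fsubTm-⨾ ρ₁ ρ₂ b)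
fsubTm-⨾ ρ₁ ρ₂ (π₁ a) = cong π₁ (fsubTm-⨾ ρ₁ ρ₂ a)
fsubTm-⨾ ρ₁ ρ₂ (π₂ a) = cong π₂ (fsubTm-⨾ ρ₁ ρ₂ a)

fsubFm-⨾ : ∀ {Γ} (ρ₁ ρ₂ : FSub) (φ : Fm Γ) → fsubFm ρ₂ (fsubFm ρ₁ φ) ≡ fsubFm (ρ₁ ⨾ ρ₂) φ
fsubFm-⨾ ρ₁ ρ₂ (a =U b) = cong₂ _=U_ (fsubTm-⨾ ρ₁ ρ₂ a) (fsubTm-⨾ ρ₁ ρ₂ b)
fsubFm-⨾ ρ₁ ρ₂ (a ≠U b) = cong₂ _≠U_ (fsubTm-⨾ ρ₁ ρ₂ a) (fsubTm-⨾ ρ₁ ρ₂ b)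
fsubFm-⨾ ρ₁ ρ₂ ⊤F = refl
fsubFm-⨾ ρ₁ ρ₂ ⊥F = refl
fsubFm-⨾ ρ₁ ρ₂ (φ ∧F ψ) = cong₂ _∧F_ (fsubFm-⨾ ρ₁ ρ₂ φ) (fsubFm-⨾ ρ₁ ρ₂ ψ)
fsubFm-⨾ ρ₁ ρ₂ (φ ∨F ψ) = cong₂ _∨F_ (fsubFm-⨾ ρ₁ ρ₂ φ) (fsubFm-⨾ ρ₁ ρ₂ ψ)
fsubFm-⨾ ρ₁ ρ₂ (∀F b φ) = cong₂ ∀F (fsubTm-⨾ ρ₁ ρ₂ b) (fsubFm-⨾ ρ₁ ρ₂ φ)
fsubFm-⨾ ρ₁ ρ₂ (∃F b φ) = cong₂ ∃F (fsubTm-⨾ ρ₁ ρ₂ b) (fsubFm-⨾ ρ₁ ρ₂ φ)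

infix 4 _≈_on_
_≈_on_ : FSub → FSub → List Var → Set
ρ ≈ ρ' on L = ∀ {S} n → (n , S) ∈ L → ρ {S} n ≡ ρ' n

≈on-++ˡ : ∀ {ρ ρ' : FSub} {L M} → ρ ≈ ρ' on L ++ M → ρ ≈ ρ' on L
≈on-++ˡ e n = e n ∘ ∈-++⁺ˡ

≈on-++ʳ : ∀ {ρ ρ' : FSub} L {M} → ρ ≈ ρ' on L ++ M → ρ ≈ ρ' on M
≈on-++ʳ L e n = e n ∘ ∈-++⁺ʳ L

fsubTm-cong : ∀ {Γ T} {ρ ρ' : FSub} (a : Tm Γ T) → ρ ≈ ρ' on fvsTm a → fsubTm ρ a ≡ fsubTm ρ' a
fsubTm-cong (fv n) e = cong wk (e n (here refl))
fsubTm-cong (bv x) e = refl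
fsubTm-cong ⟨⟩ e = refl
fsubTm-cong ⟨ a , b ⟩ e = cong₂ ⟨_,_⟩ (fsubTm-cong a (≈on-++ˡ e)) (fsubTm-cong b (≈on-++ʳ (fvsTm a) e))
fsubTm-cong (π₁ a) e = cong π₁ (fsubTm-cong a e)
fsubTm-cong (π₂ a) e = cong π₂ (fsubTm-cong a e)

fsubFm-cong : ∀ {Γ} {ρ ρ' : FSub} (φ : Fm Γ) → ρ ≈ ρ' on fvsFm φ → fsubFm ρ φ ≡ fsubFm ρ' φ
fsubFm-cong (a =U b) e = cong₂ _=U_ (fsubTm-cong a (≈on-++ˡ e)) (fsubTm-cong b (≈on-++ʳ (fvsTm a) e))
fsubFm-cong (a ≠U b) e = cong₂ _≠U_ (fsubTm-cong a (≈on-++ˡ e)) (fsubTm-cong b (≈on-++ʳ (fvsTm a) e))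
fsubFm-cong ⊤F e = refl
fsubFm-cong ⊥F e = refl
fsubFm-cong (φ ∧F ψ) e = cong₂ _∧F_ (fsubFm-cong φ (≈on-++ˡ e)) (fsubFm-cong ψ (≈on-++ʳ (fvsFm φ) e))
fsubFm-cong (φ ∨F ψ) e = cong₂ _∨F_ (fsubFm-cong φ (≈on-++ˡ e)) (fsubFm-cong ψ (≈on-++ʳ (fvsFm φ) e))
fsubFm-cong (∀F b φ) e = cong₂ ∀F (fsubTm-cong b (≈on-++ˡ e)) (fsubFm-cong φ (≈on-++ʳ (fvsTm b) e))
fsubFm-cong (∃F b φ) e = cong₂ ∃F (fsubTm-cong b (≈on-++ˡ e)) (fsubFm-cong φ (≈on-++ʳ (fvsTm b) e))

fsubTm-id : ∀ {Γ T} (a : Tm Γ T) → fsubTm fv a ≡ a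
fsubTm-id (fv n) = refl
fsubTm-id (bv x) = refl
fsubTm-id ⟨⟩ = refl
fsubTm-id ⟨ a , b ⟩ = cong₂ ⟨_,_⟩ (fsubTm-id a) (fsubTm-id b)
fsubTm-id (π₁ a) = cong π₁ (fsubTm-id a)
fsubTm-id (π₂ a) = cong π₂ (fsubTm-id a)

fsubFm-id : ∀ {Γ} (φ : Fm Γ) → fsubFm fv φ ≡ φ
fsubFm-id (a =U b) = cong₂ _=U_ (fsubTm-id a) (fsubTm-id b)
fsubFm-id (a ≠U b) = cong₂ _≠U_ (fsubTm-id a) (fsubTm-id b)
fsubFm-id ⊤F = refl
fsubFm-id ⊥F = refl
fsubFm-id (φ ∧F ψ) = cong₂ _∧F_ (fsubFm-id φ) (fsubFm-id ψ)
fsubFm-id (φ ∨F ψ) = cong₂ _∨F_ (fsubFm-id φ) (fsubFm-id ψ)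
fsubFm-id (∀F b φ) = cong₂ ∀F (fsubTm-id b) (fsubFm-id φ)
fsubFm-id (∃F b φ) = cong₂ ∃F (fsubTm-id b) (fsubFm-id φ)

subTm-cong : ∀ {Γ Δ T} {σ σ' : Sub Γ Δ} → (∀ {S} (x : Γ ∋ S) → σ x ≡ σ' x) →
             (a : Tm Γ T) → subTm σ a ≡ subTm σ' a
subTm-cong e (fv n) = refl
subTm-cong e (bv x) = e x
subTm-cong e ⟨⟩ = refl
subTm-cong e ⟨ a , b ⟩ = cong₂ ⟨_,_⟩ (subTm-cong e a) (subTm-cong e b)
subTm-cong e (π₁ a) = cong π₁ (subTm-cong e a)
subTm-cong e (π₂ a) = cong π₂ (subTm-cong e a)

extS-cong : ∀ {Γ Δ U} {σ σ' : Sub Γ Δ} → (∀ {S} (x : Γ ∋ S) → σ x ≡ σ' x) →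
            ∀ {S} (x : (U ∷ Γ) ∋ S) → extS σ x ≡ extS σ' x
extS-cong e here = refl
extS-cong e (there x) = cong (renTm there) (e x)

subFm-cong : ∀ {Γ Δ} {σ σ' : Sub Γ Δ} → (∀ {S} (x : Γ ∋ S) → σ x ≡ σ' x) →
             (φ : Fm Γ) → subFm σ φ ≡ subFm σ' φ
subFm-cong e (a =U b) = cong₂ _=U_ (subTm-cong e a) (subTm-cong e b)
subFm-cong e (a ≠U b) = cong₂ _≠U_ (subTm-cong e a) (subTm-cong e b)
subFm-cong e ⊤F = refl
subFm-cong e ⊥F = refl
subFm-cong e (φ ∧F ψ) = cong₂ _∧F_ (subFm-cong e φ) (subFm-cong e ψ)
subFm-cong e (φ ∨F ψ) = cong₂ _∨F_ (subFm-cong e φ) (subFm-cong e ψ)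
subFm-cong e (∀F b φ) = cong₂ ∀F (subTm-cong e b) (subFm-cong (extS-cong e) φ)
subFm-cong e (∃F b φ) = cong₂ ∃F (subTm-cong e b) (subFm-cong (extS-cong e) φ)

fsubTm-subTm : ∀ {Γ Δ T} (ρ : FSub) (σ : Sub Γ Δ) (a : Tm Γ T) →
               fsubTm ρ (subTm σ a) ≡ subTm (fsubTm ρ ∘ σ) (fsubTm ρ a)
fsubTm-subTm ρ σ (fv n) = sym (subTm-wk _ (ρ n))
fsubTm-subTm ρ σ (bv x) = refl
fsubTm-subTm ρ σ ⟨⟩ = refl
fsubTm-subTm ρ σ ⟨ a , b ⟩ = cong₂ ⟨_,_⟩ (fsubTm-subTm ρ σ a) (fsubTm-subTm ρ σ b)
fsubTm-subTm ρ σ (π₁ a) = cong π₁ (fsubTm-subTm ρ σ a)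
fsubTm-subTm ρ σ (π₂ a) = cong π₂ (fsubTm-subTm ρ σ a)

fsubTm-extS : ∀ {Γ Δ U} (ρ : FSub) (σ : Sub Γ Δ) {S} (x : (U ∷ Γ) ∋ S) →
              fsubTm ρ (extS σ x) ≡ extS (fsubTm ρ ∘ σ) x
fsubTm-extS ρ σ here = refl
fsubTm-extS ρ σ (there x) = fsubTm-renTm ρ there (σ x)

fsubFm-subFm : ∀ {Γ Δ} (ρ : FSub) (σ : Sub Γ Δ) (φ : Fm Γ) →
               fsubFm ρ (subFm σ φ) ≡ subFm (fsubTm ρ ∘ σ) (fsubFm ρ φ)
fsubFm-subFm ρ σ (a =U b) = cong₂ _=U_ (fsubTm-subTm ρ σ a) (fsubTm-subTm ρ σ b)
fsubFm-subFm ρ σ (a ≠U b) = cong₂ _≠U_ (fsubTm-subTm ρ σ a) (fsubTm-subTm ρ σ b)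
fsubFm-subFm ρ σ ⊤F = refl
fsubFm-subFm ρ σ ⊥F = refl
fsubFm-subFm ρ σ (φ ∧F ψ) = cong₂ _∧F_ (fsubFm-subFm ρ σ φ) (fsubFm-subFm ρ σ ψ)
fsubFm-subFm ρ σ (φ ∨F ψ) = cong₂ _∨F_ (fsubFm-subFm ρ σ φ) (fsubFm-subFm ρ σ ψ)
fsubFm-subFm ρ σ (∀F b φ) =
  cong₂ ∀F (fsubTm-subTm ρ σ b) (trans (fsubFm-subFm ρ (extS σ) φ) (subFm-cong (fsubTm-extS ρ σ) (fsubFm ρ φ)))
fsubFm-subFm ρ σ (∃F b φ) =
  cong₂ ∃F (fsubTm-subTm ρ σ b) (trans (fsubFm-subFm ρ (extS σ) φ) (subFm-cong (fsubTm-extS ρ σ) (fsubFm ρ φ)))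

fsubFm-inst : ∀ {T} (ρ : FSub) (φ : Fm (T ∷ [])) (t : Tm [] T) →
              fsubFm ρ (inst φ t) ≡ inst (fsubFm ρ φ) (fsubTm ρ t)
fsubFm-inst ρ φ t = trans (fsubFm-subFm ρ (sub₀ t) φ) (subFm-cong sub₀-fsub (fsubFm ρ φ))
  where
  sub₀-fsub : ∀ {S} (x : _ ∋ S) → fsubTm ρ (sub₀ t x) ≡ sub₀ (fsubTm ρ t) x
  sub₀-fsub here = refl
  sub₀-fsub (there ())

_≟V_ : (v w : Var) → Dec (v ≡ w)
(n , T) ≟V (m , S) with n ≟ℕ m | T ≟Ty S
... | yes refl | yes refl = yes refl
... | no n≢m | _ = no (n≢m ∘ cong proj₁)
... | yes _ | no T≢S = no (T≢S ∘ cong proj₂)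

upd : FSub → ∀ {T} → ℕ → Tm [] T → FSub
upd ρ {T} y s {T'} m with m ≟ℕ y | T' ≟Ty T
... | yes refl | yes refl = s
... | _ | _ = ρ m

upd-hit : ∀ (ρ : FSub) {T} (s : Tm [] T) n → upd ρ n s {T} n ≡ s
upd-hit ρ {T} s n with n ≟ℕ n | T ≟Ty T
... | yes refl | yes refl = refl
... | no n≢n | _ = ⊥-elim (n≢n refl)
... | yes refl | no T≢T = ⊥-elim (T≢T refl)

upd-miss : ∀ (ρ : FSub) {T T'} (s : Tm [] T) n m → (m , T') ≢ (n , T) → upd ρ n s {T'} m ≡ ρ m
upd-miss ρ {T} {T'} s n m ne with m ≟ℕ n | T' ≟Ty T
... | yes refl | yes refl = ⊥-elim (ne refl)
... | no _ | _ = refl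
... | yes refl | no _ = refl

single-upd : ∀ {T T'} (s : Tm [] T) n m → single s n {T'} m ≡ upd fv n s m
single-upd {T} {T'} s n m with m ≟ℕ n | T' ≟Ty T
... | yes refl | yes refl = refl
... | no _ | _ = refl
... | yes refl | no _ = refl

single-hit : ∀ {T} (s : Tm [] T) n → single s n {T} n ≡ s
single-hit s n = trans (single-upd s n n) (upd-hit fv s n)

single-miss : ∀ {T T'} (s : Tm [] T) n m → (m , T') ≢ (n , T) → single s n {T'} m ≡ fv m
single-miss s n m ne = trans (single-upd s n m) (upd-miss fv s n m ne)

≈on-upd : ∀ (ρ : FSub) {T} (s : Tm [] T) x (L : List Var) → (x , T) ∉ L → upd ρ x s ≈ ρ on L
≈on-upd ρ s x L x∉L m i = upd-miss ρ s x m (λ eq → x∉L (subst (_∈ L) eq i))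

fsubΘ : FSub → List Mem → List Mem
fsubΘ ρ = map (fsubMem ρ)

fsubΔ : FSub → List (Fm []) → List (Fm [])
fsubΔ ρ = map (fsubFm ρ)

fsubMem-⨾ : ∀ (ρ₁ ρ₂ : FSub) (m : Mem) → fsubMem ρ₂ (fsubMem ρ₁ m) ≡ fsubMem (ρ₁ ⨾ ρ₂) m
fsubMem-⨾ ρ₁ ρ₂ (a ∈M b) = cong₂ _∈M_ (fsubTm-⨾ ρ₁ ρ₂ a) (fsubTm-⨾ ρ₁ ρ₂ b)

fsubΘ-⨾ : ∀ (ρ₁ ρ₂ : FSub) (Θ : List Mem) → fsubΘ ρ₂ (fsubΘ ρ₁ Θ) ≡ fsubΘ (ρ₁ ⨾ ρ₂) Θ
fsubΘ-⨾ ρ₁ ρ₂ Θ = trans (sym (map-∘ Θ)) (map-cong (fsubMem-⨾ ρ₁ ρ₂) Θ)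

fsubΔ-⨾ : ∀ (ρ₁ ρ₂ : FSub) (Δ : List (Fm [])) → fsubΔ ρ₂ (fsubΔ ρ₁ Δ) ≡ fsubΔ (ρ₁ ⨾ ρ₂) Δ
fsubΔ-⨾ ρ₁ ρ₂ Δ = trans (sym (map-∘ Δ)) (map-cong (fsubFm-⨾ ρ₁ ρ₂) Δ)

fsubΘ-cong : ∀ {ρ ρ' : FSub} (Θ : List Mem) → ρ ≈ ρ' on fvsΘ Θ → fsubΘ ρ Θ ≡ fsubΘ ρ' Θ
fsubΘ-cong [] e = refl
fsubΘ-cong ((a ∈M b) ∷ Θ) e =
  cong₂ _∷_ (cong₂ _∈M_ (fsubTm-cong a (≈on-++ˡ e)) (fsubTm-cong b (≈on-++ˡ e′)))
            (fsubΘ-cong Θ (≈on-++ʳ (fvsTm b) e′))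
  where e′ = ≈on-++ʳ (fvsTm a) e

fsubΔ-cong : ∀ {ρ ρ' : FSub} (Δ : List (Fm [])) → ρ ≈ ρ' on fvsΔ Δ → fsubΔ ρ Δ ≡ fsubΔ ρ' Δ
fsubΔ-cong [] e = refl
fsubΔ-cong (φ ∷ Δ) e = cong₂ _∷_ (fsubFm-cong φ (≈on-++ˡ e)) (fsubΔ-cong Δ (≈on-++ʳ (fvsFm φ) e))

fsubΘ-id : (Θ : List Mem) → fsubΘ fv Θ ≡ Θ
fsubΘ-id Θ = trans (map-cong fsubMem-id Θ) (map-id Θ)
  where
  fsubMem-id : (m : Mem) → fsubMem fv m ≡ m
  fsubMem-id (a ∈M b) = cong₂ _∈M_ (fsubTm-id a) (fsubTm-id b)

fsubΔ-id : (Δ : List (Fm [])) → fsubΔ fv Δ ≡ Δ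
fsubΔ-id Δ = trans (map-cong fsubFm-id Δ) (map-id Δ)

++-⊆ : ∀ {A : Set} {xs ys zs : List A} → xs ⊆ zs → ys ⊆ zs → xs ++ ys ⊆ zs
++-⊆ {xs = xs} xs⊆zs ys⊆zs i = [ xs⊆zs , ys⊆zs ]′ (∈-++⁻ xs i)

fvsTm-renTm : ∀ {Γ Δ T} (r : Ren Γ Δ) (a : Tm Γ T) → fvsTm (renTm r a) ≡ fvsTm a
fvsTm-renTm r (fv n) = refl
fvsTm-renTm r (bv x) = refl
fvsTm-renTm r ⟨⟩ = refl
fvsTm-renTm r ⟨ a , b ⟩ = cong₂ _++_ (fvsTm-renTm r a) (fvsTm-renTm r b)
fvsTm-renTm r (π₁ a) = fvsTm-renTm r a
fvsTm-renTm r (π₂ a) = fvsTm-renTm r a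

ImageFv : FSub → List Var → Var → Set
ImageFv ρ L v = ∃[ n ] ∃[ S ] (n , S) ∈ L × v ∈ fvsTm (ρ {S} n)

ImageFv-++ : ∀ (ρ : FSub) {L M : List Var} (X : List Var) {Y : List Var} {v} →
             (v ∈ X → ImageFv ρ L v) → (v ∈ Y → ImageFv ρ M v) → v ∈ X ++ Y → ImageFv ρ (L ++ M) v
ImageFv-++ ρ {L = L} X f g i with ∈-++⁻ X i
... | inj₁ p = let n , S , k , l = f p in n , S , ∈-++⁺ˡ k , l
... | inj₂ p = let n , S , k , l = g p in n , S , ∈-++⁺ʳ L k , l

++-image : ∀ {A B A' B' X : List Var} {v : Var} → (v ∈ A → X ⊆ A') → (v ∈ B → X ⊆ B') →
           v ∈ A ++ B → X ⊆ A' ++ B'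
++-image {A = A} {A' = A'} {B'} f g i =
  [ (λ p → xs⊆xs++ys A' B' ∘ f p) , (λ p → xs⊆ys++xs B' A' ∘ g p) ]′ (∈-++⁻ A i)

fvsTm-fsub⁻ : ∀ {Γ T} (ρ : FSub) (a : Tm Γ T) {v} → v ∈ fvsTm (fsubTm ρ a) → ImageFv ρ (fvsTm a) v
fvsTm-fsub⁻ ρ (fv {T} n) {v} i = n , T , here refl , subst (v ∈_) (fvsTm-renTm noVar (ρ n)) i
fvsTm-fsub⁻ ρ (bv x) ()
fvsTm-fsub⁻ ρ ⟨⟩ ()
fvsTm-fsub⁻ ρ ⟨ a , b ⟩ = ImageFv-++ ρ (fvsTm (fsubTm ρ a)) (fvsTm-fsub⁻ ρ a) (fvsTm-fsub⁻ ρ b)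
fvsTm-fsub⁻ ρ (π₁ a) = fvsTm-fsub⁻ ρ a
fvsTm-fsub⁻ ρ (π₂ a) = fvsTm-fsub⁻ ρ a

fvsTm-fsub⁺ : ∀ {Γ T} (ρ : FSub) (a : Tm Γ T) {n S} → (n , S) ∈ fvsTm a →
              fvsTm (ρ {S} n) ⊆ fvsTm (fsubTm ρ a)
fvsTm-fsub⁺ ρ (fv n) (here refl) = subst (_ ∈_) (sym (fvsTm-renTm noVar (ρ n)))
fvsTm-fsub⁺ ρ (bv x) ()
fvsTm-fsub⁺ ρ ⟨⟩ ()
fvsTm-fsub⁺ ρ ⟨ a , b ⟩ i = ++-image (fvsTm-fsub⁺ ρ a) (fvsTm-fsub⁺ ρ b) i
fvsTm-fsub⁺ ρ (π₁ a) = fvsTm-fsub⁺ ρ a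
fvsTm-fsub⁺ ρ (π₂ a) = fvsTm-fsub⁺ ρ a

fvsFm-fsub⁺ : ∀ {Γ} (ρ : FSub) (φ : Fm Γ) {n S} → (n , S) ∈ fvsFm φ →
              fvsTm (ρ {S} n) ⊆ fvsFm (fsubFm ρ φ)
fvsFm-fsub⁺ ρ (a =U b) i = ++-image (fvsTm-fsub⁺ ρ a) (fvsTm-fsub⁺ ρ b) i
fvsFm-fsub⁺ ρ (a ≠U b) i = ++-image (fvsTm-fsub⁺ ρ a) (fvsTm-fsub⁺ ρ b) i
fvsFm-fsub⁺ ρ ⊤F ()
fvsFm-fsub⁺ ρ ⊥F ()
fvsFm-fsub⁺ ρ (φ ∧F ψ) i = ++-image (fvsFm-fsub⁺ ρ φ) (fvsFm-fsub⁺ ρ ψ) i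
fvsFm-fsub⁺ ρ (φ ∨F ψ) i = ++-image (fvsFm-fsub⁺ ρ φ) (fvsFm-fsub⁺ ρ ψ) i
fvsFm-fsub⁺ ρ (∀F b φ) i = ++-image (fvsTm-fsub⁺ ρ b) (fvsFm-fsub⁺ ρ φ) i
fvsFm-fsub⁺ ρ (∃F b φ) i = ++-image (fvsTm-fsub⁺ ρ b) (fvsFm-fsub⁺ ρ φ) i

fvsFm-fsub⁻ : ∀ {Γ} (ρ : FSub) (φ : Fm Γ) {v} → v ∈ fvsFm (fsubFm ρ φ) → ImageFv ρ (fvsFm φ) v
fvsFm-fsub⁻ ρ (a =U b) = ImageFv-++ ρ (fvsTm (fsubTm ρ a)) (fvsTm-fsub⁻ ρ a) (fvsTm-fsub⁻ ρ b)
fvsFm-fsub⁻ ρ (a ≠U b) = ImageFv-++ ρ (fvsTm (fsubTm ρ a)) (fvsTm-fsub⁻ ρ a) (fvsTm-fsub⁻ ρ b)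
fvsFm-fsub⁻ ρ ⊤F ()
fvsFm-fsub⁻ ρ ⊥F ()
fvsFm-fsub⁻ ρ (φ ∧F ψ) = ImageFv-++ ρ (fvsFm (fsubFm ρ φ)) (fvsFm-fsub⁻ ρ φ) (fvsFm-fsub⁻ ρ ψ)
fvsFm-fsub⁻ ρ (φ ∨F ψ) = ImageFv-++ ρ (fvsFm (fsubFm ρ φ)) (fvsFm-fsub⁻ ρ φ) (fvsFm-fsub⁻ ρ ψ)
fvsFm-fsub⁻ ρ (∀F b φ) = ImageFv-++ ρ (fvsTm (fsubTm ρ b)) (fvsTm-fsub⁻ ρ b) (fvsFm-fsub⁻ ρ φ)
fvsFm-fsub⁻ ρ (∃F b φ) = ImageFv-++ ρ (fvsTm (fsubTm ρ b)) (fvsTm-fsub⁻ ρ b) (fvsFm-fsub⁻ ρ φ)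

fvsΘ-fsub⁻ : ∀ (ρ : FSub) (Θ : List Mem) {v} → v ∈ fvsΘ (fsubΘ ρ Θ) → ImageFv ρ (fvsΘ Θ) v
fvsΘ-fsub⁻ ρ [] ()
fvsΘ-fsub⁻ ρ ((a ∈M b) ∷ Θ) =
  ImageFv-++ ρ (fvsTm (fsubTm ρ a)) (fvsTm-fsub⁻ ρ a)
    (ImageFv-++ ρ (fvsTm (fsubTm ρ b)) (fvsTm-fsub⁻ ρ b) (fvsΘ-fsub⁻ ρ Θ))

fvsΔ-fsub⁻ : ∀ (ρ : FSub) (Δ : List (Fm [])) {v} → v ∈ fvsΔ (fsubΔ ρ Δ) → ImageFv ρ (fvsΔ Δ) v
fvsΔ-fsub⁻ ρ [] ()
fvsΔ-fsub⁻ ρ (φ ∷ Δ) = ImageFv-++ ρ (fvsFm (fsubFm ρ φ)) (fvsFm-fsub⁻ ρ φ) (fvsΔ-fsub⁻ ρ Δ)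

fvsΘ-fsub⁺ : ∀ (ρ : FSub) (Θ : List Mem) {n S} → (n , S) ∈ fvsΘ Θ → fvsTm (ρ {S} n) ⊆ fvsΘ (fsubΘ ρ Θ)
fvsΘ-fsub⁺ ρ [] ()
fvsΘ-fsub⁺ ρ ((a ∈M b) ∷ Θ) i =
  ++-image (fvsTm-fsub⁺ ρ a) (++-image (fvsTm-fsub⁺ ρ b) (fvsΘ-fsub⁺ ρ Θ)) i

fvsΔ-fsub⁺ : ∀ (ρ : FSub) (Δ : List (Fm [])) {n S} → (n , S) ∈ fvsΔ Δ → fvsTm (ρ {S} n) ⊆ fvsΔ (fsubΔ ρ Δ)
fvsΔ-fsub⁺ ρ [] ()
fvsΔ-fsub⁺ ρ (φ ∷ Δ) i = ++-image (fvsFm-fsub⁺ ρ φ) (fvsΔ-fsub⁺ ρ Δ) i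

BoundImageFv : ∀ {Γ Δ} → Sub Γ Δ → Var → Set
BoundImageFv {Γ} σ v = ∃[ S ] Σ (Γ ∋ S) λ x → v ∈ fvsTm (σ x)

∈-++-⊎ : ∀ {P : Set} {A B A' B' : List Var} {v} → (v ∈ A' → v ∈ A ⊎ P) → (v ∈ B' → v ∈ B ⊎ P) →
         v ∈ A' ++ B' → v ∈ A ++ B ⊎ P
∈-++-⊎ {A = A} {A' = A'} f g i = [ map₁ ∈-++⁺ˡ ∘ f , map₁ (∈-++⁺ʳ A) ∘ g ]′ (∈-++⁻ A' i)

BoundImageFv-extS : ∀ {Γ Δ U} (σ : Sub Γ Δ) {v} → BoundImageFv (extS {S = U} σ) v → BoundImageFv σ v
BoundImageFv-extS σ (S , here , ())
BoundImageFv-extS σ {v} (S , there x , i) = S , x , subst (v ∈_) (fvsTm-renTm there (σ x)) i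

fvsTm-subTm⁻ : ∀ {Γ Δ T} (σ : Sub Γ Δ) (a : Tm Γ T) {v} → v ∈ fvsTm (subTm σ a) → v ∈ fvsTm a ⊎ BoundImageFv σ v
fvsTm-subTm⁻ σ (fv n) i = inj₁ i
fvsTm-subTm⁻ σ (bv x) i = inj₂ (_ , x , i)
fvsTm-subTm⁻ σ ⟨⟩ ()
fvsTm-subTm⁻ σ ⟨ a , b ⟩ = ∈-++-⊎ (fvsTm-subTm⁻ σ a) (fvsTm-subTm⁻ σ b)
fvsTm-subTm⁻ σ (π₁ a) = fvsTm-subTm⁻ σ a
fvsTm-subTm⁻ σ (π₂ a) = fvsTm-subTm⁻ σ a

fvsFm-subFm⁻ : ∀ {Γ Δ} (σ : Sub Γ Δ) (φ : Fm Γ) {v} → v ∈ fvsFm (subFm σ φ) → v ∈ fvsFm φ ⊎ BoundImageFv σ v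
fvsFm-subFm⁻ σ (a =U b) = ∈-++-⊎ (fvsTm-subTm⁻ σ a) (fvsTm-subTm⁻ σ b)
fvsFm-subFm⁻ σ (a ≠U b) = ∈-++-⊎ (fvsTm-subTm⁻ σ a) (fvsTm-subTm⁻ σ b)
fvsFm-subFm⁻ σ ⊤F ()
fvsFm-subFm⁻ σ ⊥F ()
fvsFm-subFm⁻ σ (φ ∧F ψ) = ∈-++-⊎ (fvsFm-subFm⁻ σ φ) (fvsFm-subFm⁻ σ ψ)
fvsFm-subFm⁻ σ (φ ∨F ψ) = ∈-++-⊎ (fvsFm-subFm⁻ σ φ) (fvsFm-subFm⁻ σ ψ)
fvsFm-subFm⁻ σ (∀F b φ) = ∈-++-⊎ (fvsTm-subTm⁻ σ b) (map₂ (BoundImageFv-extS σ) ∘ fvsFm-subFm⁻ (extS σ) φ)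
fvsFm-subFm⁻ σ (∃F b φ) = ∈-++-⊎ (fvsTm-subTm⁻ σ b) (map₂ (BoundImageFv-extS σ) ∘ fvsFm-subFm⁻ (extS σ) φ)

fvsTm-subTm⁺ : ∀ {Γ Δ T} (σ : Sub Γ Δ) (a : Tm Γ T) → fvsTm a ⊆ fvsTm (subTm σ a)
fvsTm-subTm⁺ σ (fv n) = ⊆-refl
fvsTm-subTm⁺ σ (bv x) ()
fvsTm-subTm⁺ σ ⟨⟩ ()
fvsTm-subTm⁺ σ ⟨ a , b ⟩ = ++⁺ (fvsTm-subTm⁺ σ a) (fvsTm-subTm⁺ σ b)
fvsTm-subTm⁺ σ (π₁ a) = fvsTm-subTm⁺ σ a
fvsTm-subTm⁺ σ (π₂ a) = fvsTm-subTm⁺ σ a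

fvsFm-subFm⁺ : ∀ {Γ Δ} (σ : Sub Γ Δ) (φ : Fm Γ) → fvsFm φ ⊆ fvsFm (subFm σ φ)
fvsFm-subFm⁺ σ (a =U b) = ++⁺ (fvsTm-subTm⁺ σ a) (fvsTm-subTm⁺ σ b)
fvsFm-subFm⁺ σ (a ≠U b) = ++⁺ (fvsTm-subTm⁺ σ a) (fvsTm-subTm⁺ σ b)
fvsFm-subFm⁺ σ ⊤F ()
fvsFm-subFm⁺ σ ⊥F ()
fvsFm-subFm⁺ σ (φ ∧F ψ) = ++⁺ (fvsFm-subFm⁺ σ φ) (fvsFm-subFm⁺ σ ψ)
fvsFm-subFm⁺ σ (φ ∨F ψ) = ++⁺ (fvsFm-subFm⁺ σ φ) (fvsFm-subFm⁺ σ ψ)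
fvsFm-subFm⁺ σ (∀F b φ) = ++⁺ (fvsTm-subTm⁺ σ b) (fvsFm-subFm⁺ (extS σ) φ)
fvsFm-subFm⁺ σ (∃F b φ) = ++⁺ (fvsTm-subTm⁺ σ b) (fvsFm-subFm⁺ (extS σ) φ)

fvsFm-inst⁻ : ∀ {T} (φ : Fm (T ∷ [])) (t : Tm [] T) → fvsFm (inst φ t) ⊆ fvsFm φ ++ fvsTm t
fvsFm-inst⁻ φ t i with fvsFm-subFm⁻ (sub₀ t) φ i
... | inj₁ p = ∈-++⁺ˡ p
... | inj₂ (S , here , p) = ∈-++⁺ʳ (fvsFm φ) p
... | inj₂ (S , there () , p)

fvsFm-inst⁺ : ∀ {T} (φ : Fm (T ∷ [])) (t : Tm [] T) → fvsFm φ ⊆ fvsFm (inst φ t)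
fvsFm-inst⁺ φ t = fvsFm-subFm⁺ (sub₀ t) φ

fvsMem : Mem → List Var
fvsMem (a ∈M b) = fvsTm a ++ fvsTm b

fvsΘ-⊆ : ∀ {Θ Θ'} → Θ ⊆ Θ' → fvsΘ Θ ⊆ fvsΘ Θ'
fvsΘ-⊆ {Θ} {Θ'} Θ⊆Θ' i = let m , m∈Θ , v∈m = fvsΘ-∈ Θ i in ∈-fvsΘ Θ' (Θ⊆Θ' m∈Θ) v∈m
  where
  fvsΘ-∈ : ∀ Θ {v} → v ∈ fvsΘ Θ → ∃[ m ] m ∈ Θ × v ∈ fvsMem m
  fvsΘ-∈ ((a ∈M b) ∷ Θ) i with ∈-++⁻ (fvsTm a) i
  ... | inj₁ p = _ , here refl , ∈-++⁺ˡ p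
  ... | inj₂ p with ∈-++⁻ (fvsTm b) p
  ...   | inj₁ q = _ , here refl , ∈-++⁺ʳ (fvsTm a) q
  ...   | inj₂ q = let m , m∈Θ , v∈m = fvsΘ-∈ Θ q in m , there m∈Θ , v∈m
  ∈-fvsΘ : ∀ Θ {m} → m ∈ Θ → fvsMem m ⊆ fvsΘ Θ
  ∈-fvsΘ ((a ∈M b) ∷ Θ) (here refl) = ++⁺ʳ (fvsTm a) (xs⊆xs++ys (fvsTm b) (fvsΘ Θ))
  ∈-fvsΘ ((a ∈M b) ∷ Θ) (there m∈Θ) = xs⊆ys++xs _ (fvsTm a) ∘ xs⊆ys++xs _ (fvsTm b) ∘ ∈-fvsΘ Θ m∈Θ

fvsΔ-⊆ : ∀ {Δ Δ'} → Δ ⊆ Δ' → fvsΔ Δ ⊆ fvsΔ Δ'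
fvsΔ-⊆ {Δ} {Δ'} Δ⊆Δ' i = let φ , φ∈Δ , v∈φ = fvsΔ-∈ Δ i in ∈-fvsΔ Δ' (Δ⊆Δ' φ∈Δ) v∈φ
  where
  fvsΔ-∈ : ∀ Δ {v} → v ∈ fvsΔ Δ → ∃[ φ ] φ ∈ Δ × v ∈ fvsFm φ
  fvsΔ-∈ (φ ∷ Δ) i with ∈-++⁻ (fvsFm φ) i
  ... | inj₁ p = φ , here refl , p
  ... | inj₂ p = let ψ , ψ∈Δ , v∈ψ = fvsΔ-∈ Δ p in ψ , there ψ∈Δ , v∈ψ
  ∈-fvsΔ : ∀ Δ {φ} → φ ∈ Δ → fvsFm φ ⊆ fvsΔ Δ
  ∈-fvsΔ (φ ∷ Δ) (here refl) = xs⊆xs++ys (fvsFm φ) (fvsΔ Δ)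
  ∈-fvsΔ (φ ∷ Δ) (there ψ∈Δ) = xs⊆ys++xs _ (fvsFm φ) ∘ ∈-fvsΔ Δ ψ∈Δ

maxName : List Var → ℕ
maxName [] = 0
maxName ((n , _) ∷ L) = n ⊔ maxName L

maxName-≥ : ∀ {n T} (L : List Var) → (n , T) ∈ L → n ≤ maxName L
maxName-≥ ((m , _) ∷ L) (here refl) = m≤m⊔n m (maxName L)
maxName-≥ ((m , _) ∷ L) (there i) = ≤-trans (maxName-≥ L i) (m≤n⊔m m (maxName L))

fresh : List Var → ℕ
fresh L = suc (maxName L)

fresh-∉ : ∀ (L : List Var) {T} → (fresh L , T) ∉ L
fresh-∉ L i = 1+n≰n (maxName-≥ L i)

-- Closure of the EL-normalized calculus under tuple substitutions

TupSub : FSub → Set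
TupSub ρ = ∀ {T} n → IsTuple (ρ {T} n)

IsTuple-fsub : ∀ {ρ : FSub} → TupSub ρ → ∀ {T} {t : Tm [] T} → IsTuple t → IsTuple (fsubTm ρ t)
IsTuple-fsub {ρ} tρ (tup-var {n = n}) = subst IsTuple (sym (wk-id (ρ n))) (tρ n)
IsTuple-fsub tρ (tup-pair a b) = tup-pair (IsTuple-fsub tρ a) (IsTuple-fsub tρ b)

TupSub-upd : ∀ {ρ : FSub} → TupSub ρ → ∀ {T} {s : Tm [] T} → IsTuple s → ∀ x → TupSub (upd ρ x s)
TupSub-upd tρ {T} ts x {T'} m with m ≟ℕ x | T' ≟Ty T
... | yes refl | yes refl = ts
... | no _ | _ = tρ m
... | yes refl | no _ = tρ m

TupSub-single : ∀ {T} {s : Tm [] T} → IsTuple s → ∀ x → TupSub (single s x)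
TupSub-single ts x m = subst IsTuple (sym (single-upd _ x m)) (TupSub-upd (λ _ → tup-var) ts x m)

TupSub-⨾ : ∀ {ρ₁ ρ₂ : FSub} → TupSub ρ₁ → TupSub ρ₂ → TupSub (ρ₁ ⨾ ρ₂)
TupSub-⨾ t₁ t₂ n = IsTuple-fsub t₂ (t₁ n)

IsTuple-Ur : ∀ {a : Tm [] Ur} → IsTuple a → ∃[ n ] a ≡ fv n
IsTuple-Ur (tup-var {n = n}) = n , refl

IsEL-fsub : ∀ (ρ : FSub) {φ} → IsEL φ → IsEL (fsubFm ρ φ)
IsEL-fsub ρ el-eq = el-eq
IsEL-fsub ρ el-neq = el-neq
IsEL-fsub ρ el-∃ = el-∃
IsEL-fsub ρ el-⊥ = el-⊥

EL-fsub : ∀ (ρ : FSub) {Δ} → EL Δ → EL (fsubΔ ρ Δ)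
EL-fsub ρ = AllP.map⁺ ∘ All.map (IsEL-fsub ρ)

IsAtomic-fsub : ∀ (ρ : FSub) {φ} → IsAtomic φ → IsAtomic (fsubFm ρ φ)
IsAtomic-fsub ρ at-eq = at-eq
IsAtomic-fsub ρ at-neq = at-neq

single-≈-fv : ∀ {T} (s : Tm [] T) x (L : List Var) → (x , T) ∉ L → single s x ≈ fv on L
single-≈-fv s x L x∉L m i = trans (single-upd s x m) (≈on-upd fv s x L x∉L m i)

fsubTm-single-∉ : ∀ {Γ T S} (s : Tm [] T) x (a : Tm Γ S) → (x , T) ∉ fvsTm a → fsubTm (single s x) a ≡ a
fsubTm-single-∉ s x a x∉a = trans (fsubTm-cong a (single-≈-fv s x _ x∉a)) (fsubTm-id a)

module Rename (ρ : FSub) {A : Ty} (x x' : ℕ) where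

  ρ' : FSub
  ρ' = upd ρ x (fv {T = A} x')

  -- ρ commutes past [s/x] once x is renamed to an x' that ρ does not produce
  single-⨾-≈ : (s : Tm [] A) (L : List Var) → (∀ {m S} → (m , S) ∈ L → (x' , A) ∉ fvsTm (ρ {S} m)) →
               single s x ⨾ ρ ≈ ρ' ⨾ single (fsubTm ρ s) x' on L
  single-⨾-≈ s L x'∉ρL {S} m i with (m , S) ≟V (x , A)
  ... | yes refl = begin
    fsubTm ρ (single s x x)      ≡⟨ cong (fsubTm ρ) (single-hit s x) ⟩
    fsubTm ρ s                   ≡⟨ sym (wk-id _) ⟩
    wk (fsubTm ρ s)              ≡⟨ cong wk (sym (single-hit _ x')) ⟩
    fsubTm σ (fv x')             ≡⟨ cong (fsubTm σ) (sym (upd-hit ρ (fv {T = A} x') x)) ⟩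
    fsubTm σ (ρ' x)              ∎
    where open ≡-Reasoning
          σ = single (fsubTm ρ s) x'
  ... | no m≢x = begin
    fsubTm ρ (single s x m)      ≡⟨ cong (fsubTm ρ) (single-miss s x m m≢x) ⟩
    wk (ρ m)                     ≡⟨ wk-id (ρ m) ⟩
    ρ {S} m                      ≡⟨ sym (fsubTm-single-∉ _ x' (ρ m) (x'∉ρL i)) ⟩
    fsubTm σ (ρ m)               ≡⟨ cong (fsubTm σ) (sym (upd-miss ρ (fv {T = A} x') x m m≢x)) ⟩
    fsubTm σ (ρ' m)              ∎
    where open ≡-Reasoning
          σ = single (fsubTm ρ s) x'

  fsubFm-single : (s : Tm [] A) (φ : Fm []) → (x' , A) ∉ fvsFm (fsubFm ρ φ) →
                  fsubFm ρ (φ [ s / x ]F) ≡ fsubFm ρ' φ [ fsubTm ρ s / x' ]F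
  fsubFm-single s φ x'∉ = trans (fsubFm-⨾ _ ρ φ) (trans
    (fsubFm-cong φ (single-⨾-≈ s (fvsFm φ) (λ i → x'∉ ∘ fvsFm-fsub⁺ ρ φ i)))
    (sym (fsubFm-⨾ ρ' _ φ)))

  fsubΘ-single : (s : Tm [] A) (Θ : List Mem) → (x' , A) ∉ fvsΘ (fsubΘ ρ Θ) →
                 fsubΘ ρ (Θ [ s / x ]Θ) ≡ fsubΘ ρ' Θ [ fsubTm ρ s / x' ]Θ
  fsubΘ-single s Θ x'∉ = trans (fsubΘ-⨾ _ ρ Θ) (trans
    (fsubΘ-cong Θ (single-⨾-≈ s (fvsΘ Θ) (λ i → x'∉ ∘ fvsΘ-fsub⁺ ρ Θ i)))
    (sym (fsubΘ-⨾ ρ' _ Θ)))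

  fsubΔ-single : (s : Tm [] A) (Δ : List (Fm [])) → (x' , A) ∉ fvsΔ (fsubΔ ρ Δ) →
                 fsubΔ ρ (Δ [ s / x ]Δ) ≡ fsubΔ ρ' Δ [ fsubTm ρ s / x' ]Δ
  fsubΔ-single s Δ x'∉ = trans (fsubΔ-⨾ _ ρ Δ) (trans
    (fsubΔ-cong Δ (single-⨾-≈ s (fvsΔ Δ) (λ i → x'∉ ∘ fvsΔ-fsub⁺ ρ Δ i)))
    (sym (fsubΔ-⨾ ρ' _ Δ)))

≈on-⊆ : ∀ {ρ ρ' : FSub} {L M} → L ⊆ M → ρ ≈ ρ' on M → ρ ≈ ρ' on L
≈on-⊆ L⊆M e n = e n ∘ L⊆M

module _ (Θ : List Mem) {T} (b : Tm [] (SetT T)) (φ : Fm (T ∷ [])) (Δ : List (Fm [])) where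

  ∀-sequent-Θ⊆ : fvsΘ Θ ⊆ fvsΘ Θ ++ fvsΔ (∀F b φ ∷ Δ)
  ∀-sequent-Θ⊆ = ∈-++⁺ˡ

  ∀-sequent-b⊆ : fvsTm b ⊆ fvsΘ Θ ++ fvsΔ (∀F b φ ∷ Δ)
  ∀-sequent-b⊆ = ∈-++⁺ʳ (fvsΘ Θ) ∘ ∈-++⁺ˡ ∘ ∈-++⁺ˡ

  ∀-sequent-φ⊆ : fvsFm φ ⊆ fvsΘ Θ ++ fvsΔ (∀F b φ ∷ Δ)
  ∀-sequent-φ⊆ = ∈-++⁺ʳ (fvsΘ Θ) ∘ ∈-++⁺ˡ ∘ ∈-++⁺ʳ (fvsTm b)

  ∀-sequent-Δ⊆ : fvsΔ Δ ⊆ fvsΘ Θ ++ fvsΔ (∀F b φ ∷ Δ)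
  ∀-sequent-Δ⊆ = ∈-++⁺ʳ (fvsΘ Θ) ∘ ∈-++⁺ʳ (fvsTm b ++ fvsFm φ)

fsub-∀-premise : ∀ {σ τ : FSub} Θ {T} {y w : ℕ} (b : Tm [] (SetT T)) φ Δ →
                 σ {T} y ≡ fv w → σ ≈ τ on fvsΘ Θ ++ fvsΔ (∀F b φ ∷ Δ) →
                 fsubΘ σ ((fv y ∈M b) ∷ Θ) ⊢E fsubΔ σ (inst φ (fv y) ∷ Δ) →
                 (fv w ∈M fsubTm τ b) ∷ fsubΘ τ Θ ⊢E inst (fsubFm τ φ) (fv w) ∷ fsubΔ τ Δ
fsub-∀-premise {σ} Θ {y = y} b φ Δ σy≡w σ≈τ =
  subst₂ _⊢E_
    (cong₂ _∷_ (cong₂ _∈M_ (cong wk σy≡w) (fsubTm-cong b (≈on-⊆ (∀-sequent-b⊆ Θ b φ Δ) σ≈τ)))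
               (fsubΘ-cong Θ (≈on-⊆ (∀-sequent-Θ⊆ Θ b φ Δ) σ≈τ)))
    (cong₂ _∷_ (trans (fsubFm-inst σ φ (fv y))
                      (cong₂ inst (fsubFm-cong φ (≈on-⊆ (∀-sequent-φ⊆ Θ b φ Δ) σ≈τ)) (cong wk σy≡w)))
               (fsubΔ-cong Δ (≈on-⊆ (∀-sequent-Δ⊆ Θ b φ Δ) σ≈τ)))

module _ (σ : FSub) {A B : Ty} (x x₁ x₂ : ℕ) {r₁ : Tm [] A} {r₂ : Tm [] B}
         (σx≡r : σ {A ⊗ B} x ≡ ⟨ r₁ , r₂ ⟩) (x₁≢x₂ : (x₁ , A) ≢ (x₂ , B)) where

  private
    p : Tm [] (A ⊗ B)
    p = ⟨ fv x₁ , fv x₂ ⟩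

    σ₁₂ : FSub
    σ₁₂ = upd (upd σ x₁ r₁) x₂ r₂

  single-pair-≈ : (L : List Var) → (x₁ , A) ∉ L → (x₂ , B) ∉ L → single p x ⨾ σ₁₂ ≈ σ on L
  single-pair-≈ L x₁∉L x₂∉L {S} m i with (m , S) ≟V (x , A ⊗ B)
  ... | yes refl = begin
    fsubTm σ₁₂ (single p x x)         ≡⟨ cong (fsubTm σ₁₂) (single-hit p x) ⟩
    ⟨ wk (σ₁₂ x₁) , wk (σ₁₂ x₂) ⟩     ≡⟨ cong₂ (λ a b → ⟨ wk a , wk b ⟩) σ₁₂x₁ (upd-hit _ r₂ x₂) ⟩
    ⟨ wk r₁ , wk r₂ ⟩                 ≡⟨ cong₂ ⟨_,_⟩ (wk-id r₁) (wk-id r₂) ⟩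
    ⟨ r₁ , r₂ ⟩                       ≡⟨ sym σx≡r ⟩
    σ x                               ∎
    where
    open ≡-Reasoning
    σ₁₂x₁ : σ₁₂ x₁ ≡ r₁
    σ₁₂x₁ = trans (upd-miss (upd σ x₁ r₁) r₂ x₂ x₁ x₁≢x₂) (upd-hit σ r₁ x₁)
  ... | no m≢x = begin
    fsubTm σ₁₂ (single p x m)         ≡⟨ cong (fsubTm σ₁₂) (single-miss p x m m≢x) ⟩
    wk (σ₁₂ m)                        ≡⟨ wk-id _ ⟩
    σ₁₂ m                             ≡⟨ upd-miss _ r₂ x₂ m (λ { refl → x₂∉L i }) ⟩
    upd σ x₁ r₁ m                     ≡⟨ upd-miss σ r₁ x₁ m (λ { refl → x₁∉L i }) ⟩
    σ m                               ∎
    where open ≡-Reasoning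

  fsub-η-premise : ∀ {Θ Δ} → FreshIn (x₁ , A) Θ Δ → FreshIn (x₂ , B) Θ Δ →
                   fsubΘ σ₁₂ (Θ [ p / x ]Θ) ⊢E fsubΔ σ₁₂ (Δ [ p / x ]Δ) → fsubΘ σ Θ ⊢E fsubΔ σ Δ
  fsub-η-premise {Θ} {Δ} x₁∉ x₂∉ = subst₂ _⊢E_
    (trans (fsubΘ-⨾ _ σ₁₂ Θ) (fsubΘ-cong Θ (single-pair-≈ _ (x₁∉ ∘ ∈-++⁺ˡ) (x₂∉ ∘ ∈-++⁺ˡ))))
    (trans (fsubΔ-⨾ _ σ₁₂ Δ) (fsubΔ-cong Δ (single-pair-≈ _ (x₁∉ ∘ ∈-++⁺ʳ _) (x₂∉ ∘ ∈-++⁺ʳ _))))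

SubstRule : ∀ {A} → ℕ → Tm [] A → Tm [] A → Set
SubstRule x s s' = ∀ {Θ Δ} → EL Δ → Θ [ s / x ]Θ ⊢E Δ [ s / x ]Δ → Θ [ s' / x ]Θ ⊢E Δ [ s' / x ]Δ

fsub-[/]-rule : ∀ {Θ Δ A} (ρ : FSub) x (s s' : Tm [] A) → (∀ x' → SubstRule x' (fsubTm ρ s) (fsubTm ρ s')) →
                EL Δ → fsubΘ ρ (Θ [ s / x ]Θ) ⊢E fsubΔ ρ (Δ [ s / x ]Δ) →
                fsubΘ ρ (Θ [ s' / x ]Θ) ⊢E fsubΔ ρ (Δ [ s' / x ]Δ)
fsub-[/]-rule {Θ} {Δ} {A} ρ x s s' rule el d =
  subst₂ _⊢E_ (sym (fsubΘ-single s' Θ x'∉Θ)) (sym (fsubΔ-single s' Δ x'∉Δ))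
    (rule x' (EL-fsub ρ' el) (subst₂ _⊢E_ (fsubΘ-single s Θ x'∉Θ) (fsubΔ-single s Δ x'∉Δ) d))
  where
  L = fvsΘ (fsubΘ ρ Θ) ++ fvsΔ (fsubΔ ρ Δ)
  x' = fresh L
  open Rename ρ {A} x x'
  x'∉Θ = fresh-∉ L ∘ ∈-++⁺ˡ
  x'∉Δ = fresh-∉ L ∘ ∈-++⁺ʳ (fvsΘ (fsubΘ ρ Θ))

⊢E-fsub : ∀ {Θ Δ} → Θ ⊢E Δ → ∀ {ρ : FSub} → TupSub ρ → fsubΘ ρ Θ ⊢E fsubΔ ρ Δ
⊢E-fsub (permE p q d) tρ = permE (PermP.map⁺ _ p) (PermP.map⁺ _ q) (⊢E-fsub d tρ)
⊢E-fsub {Θ} {_ ∷ Δ} (axEqE n) {ρ} tρ with IsTuple-Ur (tρ n)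
... | m , ρn≡m = subst (λ a → fsubΘ ρ Θ ⊢E (a =U a) ∷ fsubΔ ρ Δ) (sym (trans (wk-id (ρ n)) ρn≡m)) (axEqE m)
⊢E-fsub axTopE tρ = axTopE
⊢E-fsub {Θ} {_ ∷ _ ∷ Δ} (neqE {t = t} {u} {α} n at el d) {ρ} tρ =
  subst (λ φ → _ ⊢E _ ∷ φ ∷ fsubΔ ρ Δ) (sym (α[ t ]))
    (neqE n' (IsAtomic-fsub ρ' at) (EL-fsub ρ el)
      (subst₂ (λ φ ψ → _ ⊢E _ ∷ φ ∷ ψ ∷ fsubΔ ρ Δ) α[ u ] α[ t ] (⊢E-fsub d tρ)))
  where
  n' = fresh (fvsFm (fsubFm ρ α))
  open Rename ρ n n'
  α[_] : (s : Tm [] Ur) → fsubFm ρ (α [ s / n ]F) ≡ fsubFm ρ' α [ fsubTm ρ s / n' ]F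
  α[ s ] = fsubFm-single s α (fresh-∉ _)
⊢E-fsub (andE d₁ d₂) tρ = andE (⊢E-fsub d₁ tρ) (⊢E-fsub d₂ tρ)
⊢E-fsub (orE d) tρ = orE (⊢E-fsub d tρ)
⊢E-fsub {Θ} {_ ∷ Δ} (allE {T = T} {b} {φ} y fr d) {ρ} tρ =
  allE w (fresh-∉ _)
    (fsub-∀-premise Θ b φ Δ (upd-hit ρ (fv w) y) (≈on-upd ρ (fv w) y _ fr)
      (⊢E-fsub d (TupSub-upd tρ tup-var y)))
  where w = fresh (fvsΘ (fsubΘ ρ Θ) ++ fvsΔ (fsubΔ ρ (∀F b φ ∷ Δ)))
⊢E-fsub (exE {φ = φ} t t-tup el d) {ρ} tρ =
  exE (fsubTm ρ t) (IsTuple-fsub tρ t-tup) (EL-fsub ρ el)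
    (subst (λ ψ → _ ⊢E ψ ∷ _) (fsubFm-inst ρ φ t) (⊢E-fsub d tρ))
⊢E-fsub (etaE {Θ} {Δ} {A} {B} x x₁ x₂ el x₁∉ x₂∉ x₁≢x₂ d) {ρ} tρ with ρ {A ⊗ B} x in ρx | tρ {A ⊗ B} x
... | ⟨ r₁ , r₂ ⟩ | tup-pair r₁-tup r₂-tup =
  fsub-η-premise ρ x x₁ x₂ ρx x₁≢x₂ x₁∉ x₂∉ (⊢E-fsub d (TupSub-upd (TupSub-upd tρ r₁-tup x₁) r₂-tup x₂))
... | fv v | tup-var =
  etaE v w₁ w₂ (EL-fsub ρ el) (fresh-∉ L) (fresh-∉ ((w₁ , A) ∷ L) ∘ there) (λ e → fresh-∉ ((w₁ , A) ∷ L) (here (sym e)))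
    (subst₂ _⊢E_ (sym (fsubΘ-⨾ ρ _ Θ)) (sym (fsubΔ-⨾ ρ _ Δ))
      (fsub-η-premise (ρ ⨾ single q v) x x₁ x₂ σx x₁≢x₂ x₁∉ x₂∉
        (⊢E-fsub d (TupSub-upd (TupSub-upd (TupSub-⨾ tρ (TupSub-single (tup-pair tup-var tup-var) v)) tup-var x₁) tup-var x₂))))
  where
  L = fvsΘ (fsubΘ ρ Θ) ++ fvsΔ (fsubΔ ρ Δ)
  w₁ = fresh L
  w₂ = fresh ((w₁ , A) ∷ L)
  q = ⟨ fv {T = A} w₁ , fv {T = B} w₂ ⟩
  σx : fsubTm (single q v) (ρ x) ≡ q
  σx = trans (cong (fsubTm (single q v)) ρx) (cong wk (single-hit q v))
⊢E-fsub (beta₁E x t₁ t₂ el d) {ρ} tρ =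
  fsub-[/]-rule ρ x t₁ (π₁ ⟨ t₁ , t₂ ⟩) (λ x' → beta₁E x' (fsubTm ρ t₁) (fsubTm ρ t₂)) el (⊢E-fsub d tρ)
⊢E-fsub (beta₂E x t₁ t₂ el d) {ρ} tρ =
  fsub-[/]-rule ρ x t₂ (π₂ ⟨ t₁ , t₂ ⟩) (λ x' → beta₂E x' (fsubTm ρ t₁) (fsubTm ρ t₂)) el (⊢E-fsub d tρ)

-- Invertibility of the rules for ∧, ∨ and ∀

↭-∷-inv : ∀ {A : Set} {x y : A} {xs ys} → x ∷ xs ↭ y ∷ ys →
          (x ≡ y × xs ↭ ys) ⊎ ∃[ zs ] (xs ↭ y ∷ zs × ys ↭ x ∷ zs)
↭-∷-inv {x = x} {y} p with PermP.∈-resp-↭ (↭-sym p) (here refl)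
... | here refl = inj₁ (refl , PermP.drop-∷ p)
... | there y∈xs with ∈-∃++ y∈xs
...   | as , bs , refl = inj₂ (as ++ bs , PermP.shift y as bs ,
          PermP.drop-∷ (↭-trans (↭-sym p) (↭-trans (prep x (PermP.shift y as bs)) (swap x y ↭-refl))))

swap-heads : ∀ {A : Set} (x y : A) xs → x ∷ y ∷ xs ↭ y ∷ x ∷ xs
swap-heads x y xs = swap x y ↭-refl

↭-under : ∀ {A : Set} (ws : List A) {y ys zs} → ys ↭ y ∷ zs → ws ++ ys ↭ y ∷ ws ++ zs
↭-under ws {y} {zs = zs} r = ↭-trans (PermP.++⁺ˡ ws r) (PermP.shift y ws zs)

data NonEL : Fm [] → Set where
  ne⊤ : NonEL ⊤F
  ne∧ : ∀ {A B} → NonEL (A ∧F B)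
  ne∨ : ∀ {A B} → NonEL (A ∨F B)
  ne∀ : ∀ {T} {b : Tm [] (SetT T)} {φ} → NonEL (∀F b φ)

EL-∌-NonEL : ∀ {Γ D Δ} → EL Γ → Γ ↭ D ∷ Δ → NonEL D → ⊥
EL-∌-NonEL el r nd = ¬IsEL nd (All.lookup el (PermP.∈-resp-↭ (↭-sym r) (here refl)))
  where
  ¬IsEL : ∀ {D} → NonEL D → ¬ IsEL D
  ¬IsEL ne⊤ ()
  ¬IsEL ne∧ ()
  ¬IsEL ne∨ ()
  ¬IsEL ne∀ ()

EL-neq : ∀ {t u : Tm [] Ur} {α : Fm []} {Δ} n → IsAtomic α → EL Δ → EL ((t ≠U u) ∷ (α [ t / n ]F) ∷ Δ)
EL-neq n at-eq el = el-neq ∷ el-eq ∷ el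
EL-neq n at-neq el = el-neq ∷ el-neq ∷ el

fvsΔ-++ : ∀ (Es Δ : List (Fm [])) → fvsΔ (Es ++ Δ) ≡ fvsΔ Es ++ fvsΔ Δ
fvsΔ-++ [] Δ = refl
fvsΔ-++ (φ ∷ Es) Δ = trans (cong (fvsFm φ ++_) (fvsΔ-++ Es Δ)) (sym (++-assoc (fvsFm φ) (fvsΔ Es) (fvsΔ Δ)))

fvsΔ-replace : ∀ {D zs Δ} (Es : List (Fm [])) → Δ ↭ D ∷ zs → fvsΔ Es ⊆ fvsFm D → fvsΔ (Es ++ zs) ⊆ fvsΔ Δ
fvsΔ-replace {zs = zs} Es r Es⊆D =
  fvsΔ-⊆ (PermP.∈-resp-↭ (↭-sym r)) ∘ ++⁺ Es⊆D ⊆-refl ∘ subst (_ ∈_) (fvsΔ-++ Es zs)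

FreshIn-Δ⊆ : ∀ {v} Θ {Δ Δ'} → fvsΔ Δ' ⊆ fvsΔ Δ → FreshIn v Θ Δ → FreshIn v Θ Δ'
FreshIn-Δ⊆ Θ Δ'⊆Δ fr = fr ∘ ++⁺ʳ (fvsΘ Θ) Δ'⊆Δ

FreshIn-replace : ∀ {v D zs Δ} Θ Φ (Es : List (Fm [])) → Δ ↭ D ∷ zs → fvsΔ Es ⊆ fvsFm D →
                  FreshIn v Θ (Φ ∷ Δ) → FreshIn v Θ (Φ ∷ Es ++ zs)
FreshIn-replace {zs = zs} {Δ} Θ Φ Es r Es⊆D =
  FreshIn-Δ⊆ Θ {Φ ∷ Δ} {Φ ∷ Es ++ zs} (++⁺ʳ (fvsFm Φ) (fvsΔ-replace Es r Es⊆D))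

module _ {v : Var} (Θ : List Mem) (A B : Fm []) (Δ : List (Fm [])) where

  FreshIn-∧ˡ : FreshIn v Θ ((A ∧F B) ∷ Δ) → FreshIn v Θ (A ∷ Δ)
  FreshIn-∧ˡ = FreshIn-Δ⊆ Θ {(A ∧F B) ∷ Δ} {A ∷ Δ} (++⁺ (xs⊆xs++ys (fvsFm A) (fvsFm B)) ⊆-refl)

  FreshIn-∧ʳ : FreshIn v Θ ((A ∧F B) ∷ Δ) → FreshIn v Θ (B ∷ Δ)
  FreshIn-∧ʳ = FreshIn-Δ⊆ Θ {(A ∧F B) ∷ Δ} {B ∷ Δ} (++⁺ (xs⊆ys++xs (fvsFm B) (fvsFm A)) ⊆-refl)

  FreshIn-∨ : FreshIn v Θ ((A ∨F B) ∷ Δ) → FreshIn v Θ (A ∷ B ∷ Δ)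
  FreshIn-∨ = FreshIn-Δ⊆ Θ {(A ∨F B) ∷ Δ} {A ∷ B ∷ Δ} (⊆-reflexive (sym (++-assoc (fvsFm A) (fvsFm B) (fvsΔ Δ))))

fvs-∧ˡ : ∀ A B → fvsΔ (A ∷ []) ⊆ fvsFm (A ∧F B)
fvs-∧ˡ A B = ++-⊆ (xs⊆xs++ys (fvsFm A) (fvsFm B)) λ ()

fvs-∧ʳ : ∀ A B → fvsΔ (B ∷ []) ⊆ fvsFm (A ∧F B)
fvs-∧ʳ A B = ++-⊆ (xs⊆ys++xs (fvsFm B) (fvsFm A)) λ ()

fvs-∨ : ∀ A B → fvsΔ (A ∷ B ∷ []) ⊆ fvsFm (A ∨F B)
fvs-∨ A B = ++⁺ʳ (fvsFm A) (++-⊆ ⊆-refl λ ())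

⊢E-↭ : ∀ {Θ Δ Δ'} → Δ ↭ Δ' → Θ ⊢E Δ → Θ ⊢E Δ'
⊢E-↭ = permE ↭-refl

⊢E-swap : ∀ {Θ A B Δ} → Θ ⊢E A ∷ B ∷ Δ → Θ ⊢E B ∷ A ∷ Δ
⊢E-swap = ⊢E-↭ (swap _ _ ↭-refl)

⊢E-shift : ∀ {Θ P zs} ws → Θ ⊢E ws ++ P ∷ zs → Θ ⊢E P ∷ ws ++ zs
⊢E-shift ws = ⊢E-↭ (PermP.shift _ ws _)

⊢E-unpull : ∀ {Θ P zs Δ} ws → Δ ↭ P ∷ zs → Θ ⊢E P ∷ ws ++ zs → Θ ⊢E ws ++ Δ
⊢E-unpull ws r = ⊢E-↭ (↭-sym (↭-under ws r))

⊢E-∧-inv : ∀ {Θ Γ} → Θ ⊢E Γ → ∀ {A B Δ} → Γ ↭ (A ∧F B) ∷ Δ → (Θ ⊢E A ∷ Δ) × (Θ ⊢E B ∷ Δ)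
⊢E-∧-inv (permE p q d) r = let dA , dB = ⊢E-∧-inv d (↭-trans q r) in permE p ↭-refl dA , permE p ↭-refl dB
⊢E-∧-inv (neqE n at el d) r = ⊥-elim (EL-∌-NonEL (EL-neq n at el) r ne∧)
⊢E-∧-inv (exE t t-tup el d) r = ⊥-elim (EL-∌-NonEL (el-∃ ∷ el) r ne∧)
⊢E-∧-inv (etaE x x₁ x₂ el x₁∉ x₂∉ x₁≢x₂ d) r = ⊥-elim (EL-∌-NonEL el r ne∧)
⊢E-∧-inv (beta₁E x t₁ t₂ el d) r = ⊥-elim (EL-∌-NonEL (EL-fsub _ el) r ne∧)
⊢E-∧-inv (beta₂E x t₁ t₂ el d) r = ⊥-elim (EL-∌-NonEL (EL-fsub _ el) r ne∧)
⊢E-∧-inv (andE d₁ d₂) r with ↭-∷-inv r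
... | inj₁ (refl , r′) = ⊢E-↭ (prep _ r′) d₁ , ⊢E-↭ (prep _ r′) d₂
... | inj₂ (zs , r₁ , r₂) =
  let dA₁ , dB₁ = ⊢E-∧-inv d₁ (↭-under (_ ∷ []) r₁)
      dA₂ , dB₂ = ⊢E-∧-inv d₂ (↭-under (_ ∷ []) r₁)
  in  ⊢E-unpull (_ ∷ []) r₂ (andE (⊢E-swap dA₁) (⊢E-swap dA₂))
    , ⊢E-unpull (_ ∷ []) r₂ (andE (⊢E-swap dB₁) (⊢E-swap dB₂))
⊢E-∧-inv (axEqE n) r with ↭-∷-inv r
... | inj₂ (zs , r₁ , r₂) = ⊢E-unpull (_ ∷ []) r₂ (axEqE n) , ⊢E-unpull (_ ∷ []) r₂ (axEqE n)
⊢E-∧-inv axTopE r with ↭-∷-inv r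
... | inj₂ (zs , r₁ , r₂) = ⊢E-unpull (_ ∷ []) r₂ axTopE , ⊢E-unpull (_ ∷ []) r₂ axTopE
⊢E-∧-inv (orE d) r with ↭-∷-inv r
... | inj₂ (zs , r₁ , r₂) =
  let dA , dB = ⊢E-∧-inv d (↭-under (_ ∷ _ ∷ []) r₁)
  in  ⊢E-unpull (_ ∷ []) r₂ (orE (⊢E-↭ (↭-sym (PermP.shift _ (_ ∷ _ ∷ []) _)) dA))
    , ⊢E-unpull (_ ∷ []) r₂ (orE (⊢E-↭ (↭-sym (PermP.shift _ (_ ∷ _ ∷ []) _)) dB))
⊢E-∧-inv (allE {Θ} {b = b} {φ} y fr d) {A} {B} r with ↭-∷-inv r
... | inj₂ (zs , r₁ , r₂) =
  let dA , dB = ⊢E-∧-inv d (↭-under (_ ∷ []) r₁)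
  in  ⊢E-unpull (_ ∷ []) r₂ (allE y (FreshIn-replace Θ (∀F b φ) (A ∷ []) r₁ (fvs-∧ˡ A B) fr) (⊢E-swap dA))
    , ⊢E-unpull (_ ∷ []) r₂ (allE y (FreshIn-replace Θ (∀F b φ) (B ∷ []) r₁ (fvs-∧ʳ A B) fr) (⊢E-swap dB))

⊢E-∨-inv : ∀ {Θ Γ} → Θ ⊢E Γ → ∀ {A B Δ} → Γ ↭ (A ∨F B) ∷ Δ → Θ ⊢E A ∷ B ∷ Δ
⊢E-∨-inv (permE p q d) r = permE p ↭-refl (⊢E-∨-inv d (↭-trans q r))
⊢E-∨-inv (neqE n at el d) r = ⊥-elim (EL-∌-NonEL (EL-neq n at el) r ne∨)
⊢E-∨-inv (exE t t-tup el d) r = ⊥-elim (EL-∌-NonEL (el-∃ ∷ el) r ne∨)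
⊢E-∨-inv (etaE x x₁ x₂ el x₁∉ x₂∉ x₁≢x₂ d) r = ⊥-elim (EL-∌-NonEL el r ne∨)
⊢E-∨-inv (beta₁E x t₁ t₂ el d) r = ⊥-elim (EL-∌-NonEL (EL-fsub _ el) r ne∨)
⊢E-∨-inv (beta₂E x t₁ t₂ el d) r = ⊥-elim (EL-∌-NonEL (EL-fsub _ el) r ne∨)
⊢E-∨-inv (orE d) r with ↭-∷-inv r
... | inj₁ (refl , r′) = ⊢E-↭ (prep _ (prep _ r′)) d
... | inj₂ (zs , r₁ , r₂) =
  ⊢E-unpull (_ ∷ _ ∷ []) r₂
    (orE (⊢E-↭ (PermP.shifts (_ ∷ _ ∷ []) (_ ∷ _ ∷ [])) (⊢E-∨-inv d (↭-under (_ ∷ _ ∷ []) r₁))))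
⊢E-∨-inv (andE d₁ d₂) r with ↭-∷-inv r
... | inj₂ (zs , r₁ , r₂) =
  ⊢E-unpull (_ ∷ _ ∷ []) r₂ (andE (⊢E-shift (_ ∷ _ ∷ []) (⊢E-∨-inv d₁ (↭-under (_ ∷ []) r₁)))
                                  (⊢E-shift (_ ∷ _ ∷ []) (⊢E-∨-inv d₂ (↭-under (_ ∷ []) r₁))))
⊢E-∨-inv (axEqE n) r with ↭-∷-inv r
... | inj₂ (zs , r₁ , r₂) = ⊢E-unpull (_ ∷ _ ∷ []) r₂ (axEqE n)
⊢E-∨-inv axTopE r with ↭-∷-inv r
... | inj₂ (zs , r₁ , r₂) = ⊢E-unpull (_ ∷ _ ∷ []) r₂ axTopE
⊢E-∨-inv (allE {Θ} {b = b} {φ} y fr d) {A} {B} r with ↭-∷-inv r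
... | inj₂ (zs , r₁ , r₂) =
  ⊢E-unpull (_ ∷ _ ∷ []) r₂ (allE y (FreshIn-replace Θ (∀F b φ) (A ∷ B ∷ []) r₁ (fvs-∨ A B) fr)
                                    (⊢E-shift (_ ∷ _ ∷ []) (⊢E-∨-inv d (↭-under (_ ∷ []) r₁))))

FreshIn-↭ : ∀ {v Δ Δ'} Θ → Δ ↭ Δ' → FreshIn v Θ Δ' → FreshIn v Θ Δ
FreshIn-↭ {Δ = Δ} {Δ'} Θ p = FreshIn-Δ⊆ Θ {Δ'} {Δ} (fvsΔ-⊆ (PermP.∈-resp-↭ p))

module _ {T} (z : ℕ) (Θ : List Mem) (b : Tm [] (SetT T)) (φ : Fm (T ∷ [])) (Δ : List (Fm [])) where

  fvs-∀-premise : fvsΘ ((fv z ∈M b) ∷ Θ) ++ fvsΔ (inst φ (fv z) ∷ Δ) ⊆ (z , T) ∷ fvsΘ Θ ++ fvsΔ (∀F b φ ∷ Δ)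
  fvs-∀-premise (here e) = here e
  fvs-∀-premise (there i) =
    ++-⊆ (++-⊆ (there ∘ ∀-sequent-b⊆ Θ b φ Δ) (there ∘ ∀-sequent-Θ⊆ Θ b φ Δ))
         (++-⊆ inst⊆ (there ∘ ∀-sequent-Δ⊆ Θ b φ Δ)) i
    where
    inst⊆ : fvsFm (inst φ (fv z)) ⊆ (z , T) ∷ fvsΘ Θ ++ fvsΔ (∀F b φ ∷ Δ)
    inst⊆ j with ∈-++⁻ (fvsFm φ) (fvsFm-inst⁻ φ (fv z) j)
    ... | inj₁ k = there (∀-sequent-φ⊆ Θ b φ Δ k)
    ... | inj₂ (here e) = here e

  fvs-∀-conclusion : fvsΘ Θ ++ fvsΔ (∀F b φ ∷ Δ) ⊆ fvsΘ ((fv z ∈M b) ∷ Θ) ++ fvsΔ (inst φ (fv z) ∷ Δ)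
  fvs-∀-conclusion =
    ++-⊆ (there ∘ ∈-++⁺ˡ ∘ ∈-++⁺ʳ (fvsTm b))
         (++-⊆ (++-⊆ (there ∘ ∈-++⁺ˡ ∘ ∈-++⁺ˡ)
                     (there ∘ ∈-++⁺ʳ (fvsTm b ++ fvsΘ Θ) ∘ ∈-++⁺ˡ ∘ fvsFm-inst⁺ φ (fv z)))
               (there ∘ ∈-++⁺ʳ (fvsTm b ++ fvsΘ Θ) ∘ ∈-++⁺ʳ (fvsFm (inst φ (fv z)))))

  FreshIn-∀-premise : ∀ {v} → v ≢ (z , T) → FreshIn v Θ (∀F b φ ∷ Δ) →
                      FreshIn v ((fv z ∈M b) ∷ Θ) (inst φ (fv z) ∷ Δ)
  FreshIn-∀-premise v≢z fr i with fvs-∀-premise i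
  ... | here e = v≢z e
  ... | there j = fr j

  FreshIn-∀-conclusion : ∀ {v} → FreshIn v ((fv z ∈M b) ∷ Θ) (inst φ (fv z) ∷ Δ) → FreshIn v Θ (∀F b φ ∷ Δ)
  FreshIn-∀-conclusion fr = fr ∘ fvs-∀-conclusion

∀-premise-rename : ∀ {T y z Θ} {b : Tm [] (SetT T)} {φ Δ} → FreshIn (y , T) Θ (∀F b φ ∷ Δ) →
                   (fv y ∈M b) ∷ Θ ⊢E inst φ (fv y) ∷ Δ → (fv z ∈M b) ∷ Θ ⊢E inst φ (fv z) ∷ Δ
∀-premise-rename {y = y} {z} {Θ} {b} {φ} {Δ} fr d =
  subst₂ _⊢E_ (cong₂ (λ c Θ′ → (fv z ∈M c) ∷ Θ′) (fsubTm-id b) (fsubΘ-id Θ))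
              (cong₂ (λ ψ Δ′ → inst ψ (fv z) ∷ Δ′) (fsubFm-id φ) (fsubΔ-id Δ))
    (fsub-∀-premise Θ b φ Δ (single-hit (fv z) y) (single-≈-fv (fv z) y _ fr) (⊢E-fsub d (TupSub-single tup-var y)))

⊢E-∀-inv : ∀ {Θ Γ} → Θ ⊢E Γ → ∀ {T} {b : Tm [] (SetT T)} {φ Δ} → Γ ↭ ∀F b φ ∷ Δ →
           ∀ z → FreshIn (z , T) Θ (∀F b φ ∷ Δ) → (fv z ∈M b) ∷ Θ ⊢E inst φ (fv z) ∷ Δ
⊢E-∀-inv (permE p q d) r z fr =
  permE (prep _ p) ↭-refl (⊢E-∀-inv d (↭-trans q r) z (fr ∘ ++⁺ (fvsΘ-⊆ (PermP.∈-resp-↭ p)) ⊆-refl))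
⊢E-∀-inv (neqE n at el d) r z fr = ⊥-elim (EL-∌-NonEL (EL-neq n at el) r ne∀)
⊢E-∀-inv (exE t t-tup el d) r z fr = ⊥-elim (EL-∌-NonEL (el-∃ ∷ el) r ne∀)
⊢E-∀-inv (etaE x x₁ x₂ el x₁∉ x₂∉ x₁≢x₂ d) r z fr = ⊥-elim (EL-∌-NonEL el r ne∀)
⊢E-∀-inv (beta₁E x t₁ t₂ el d) r z fr = ⊥-elim (EL-∌-NonEL (EL-fsub _ el) r ne∀)
⊢E-∀-inv (beta₂E x t₁ t₂ el d) r z fr = ⊥-elim (EL-∌-NonEL (EL-fsub _ el) r ne∀)
⊢E-∀-inv (axEqE n) r z fr with ↭-∷-inv r
... | inj₂ (zs , r₁ , r₂) = ⊢E-unpull (_ ∷ []) r₂ (axEqE n)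
⊢E-∀-inv axTopE r z fr with ↭-∷-inv r
... | inj₂ (zs , r₁ , r₂) = ⊢E-unpull (_ ∷ []) r₂ axTopE
⊢E-∀-inv {Θ} (andE {φ₁ = P₁} {P₂} d₁ d₂) {b = b} {φ} r z fr with ↭-∷-inv r
... | inj₂ (zs , r₁ , r₂) =
  ⊢E-unpull (_ ∷ []) r₂
    (andE (⊢E-swap (⊢E-∀-inv d₁ (↭-under (_ ∷ []) r₁) z (FreshIn-replace Θ (∀F b φ) (P₁ ∷ []) r₂ (fvs-∧ˡ P₁ P₂) fr)))
          (⊢E-swap (⊢E-∀-inv d₂ (↭-under (_ ∷ []) r₁) z (FreshIn-replace Θ (∀F b φ) (P₂ ∷ []) r₂ (fvs-∧ʳ P₁ P₂) fr))))
⊢E-∀-inv {Θ} (orE {φ₁ = P₁} {P₂} d) {b = b} {φ} r z fr with ↭-∷-inv r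
... | inj₂ (zs , r₁ , r₂) =
  ⊢E-unpull (_ ∷ []) r₂ (orE (⊢E-↭ (PermP.shifts (_ ∷ []) (_ ∷ _ ∷ []))
    (⊢E-∀-inv d (↭-under (_ ∷ _ ∷ []) r₁) z (FreshIn-replace Θ (∀F b φ) (P₁ ∷ P₂ ∷ []) r₂ (fvs-∨ P₁ P₂) fr))))
⊢E-∀-inv (allE {φ = ψ} y fr' d) r z fr with ↭-∷-inv r
... | inj₁ (refl , r′) = ⊢E-↭ (prep _ r′) (∀-premise-rename {φ = ψ} fr' d)
-- y might be z: invert at a fresh z' below y's ∀ instead, and rename z' to z at the end
⊢E-∀-inv {Θ} (allE {T = T'} {b'} {ψ} y fr' d) {T} {b} {φ} r z fr | inj₂ (zs , r₁ , r₂) =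
  ⊢E-unpull (_ ∷ []) r₂ (⊢E-swap (∀-premise-rename {φ = φ} z'-fresh (⊢E-swap d′)))
  where
  Θy = (fv y ∈M b') ∷ Θ
  L = fvsΘ Θy ++ fvsΔ (inst ψ (fv y) ∷ ∀F b φ ∷ zs)
  z' = fresh L
  z'-fresh : FreshIn (z' , T) Θ (∀F b φ ∷ ∀F b' ψ ∷ zs)
  z'-fresh = FreshIn-↭ Θ (swap-heads (∀F b φ) (∀F b' ψ) zs) (FreshIn-∀-conclusion y Θ b' ψ (∀F b φ ∷ zs) (fresh-∉ L))
  y≢z' : (y , T') ≢ (z' , T)
  y≢z' e = fresh-∉ L (∈-++⁺ˡ (subst (_∈ fvsΘ Θy) e (here refl)))
  y-fresh : FreshIn (y , T') ((fv z' ∈M b) ∷ Θ) (∀F b' ψ ∷ inst φ (fv z') ∷ zs)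
  y-fresh = FreshIn-↭ ((fv z' ∈M b) ∷ Θ) (swap-heads (∀F b' ψ) (inst φ (fv z')) zs)
              (FreshIn-∀-premise z' Θ b φ (∀F b' ψ ∷ zs) y≢z'
                (FreshIn-↭ Θ (↭-trans (swap-heads (∀F b φ) (∀F b' ψ) zs) (prep _ (↭-sym r₁))) fr'))
  d′ : (fv z' ∈M b) ∷ Θ ⊢E ∀F b' ψ ∷ inst φ (fv z') ∷ zs
  d′ = allE y y-fresh (permE (swap _ _ ↭-refl) (swap _ _ ↭-refl)
         (⊢E-∀-inv d (↭-under (_ ∷ []) r₁) z' (FreshIn-↭ Θy (swap-heads (∀F b φ) (inst ψ (fv y)) zs) (fresh-∉ L))))

-- Decomposing the non-EL part of a succedent

weight : ∀ {Γ} → Fm Γ → ℕ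
weight (a =U b) = 0
weight (a ≠U b) = 0
weight ⊤F = 1
weight ⊥F = 0
weight (φ ∧F ψ) = suc (weight φ + weight ψ)
weight (φ ∨F ψ) = suc (weight φ + weight ψ)
weight (∀F b φ) = suc (weight φ)
weight (∃F b φ) = 0

weightΔ : List (Fm []) → ℕ
weightΔ [] = 0
weightΔ (φ ∷ Δ) = weight φ + weightΔ Δ

weight-subFm : ∀ {Γ Δ} (σ : Sub Γ Δ) (φ : Fm Γ) → weight (subFm σ φ) ≡ weight φ
weight-subFm σ (a =U b) = refl
weight-subFm σ (a ≠U b) = refl
weight-subFm σ ⊤F = refl
weight-subFm σ ⊥F = refl
weight-subFm σ (φ ∧F ψ) = cong₂ (λ m n → suc (m + n)) (weight-subFm σ φ) (weight-subFm σ ψ)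
weight-subFm σ (φ ∨F ψ) = cong₂ (λ m n → suc (m + n)) (weight-subFm σ φ) (weight-subFm σ ψ)
weight-subFm σ (∀F b φ) = cong suc (weight-subFm (extS σ) φ)
weight-subFm σ (∃F b φ) = refl

NonELSplit : List (Fm []) → Set
NonELSplit Δ = ∃[ D ] ∃[ Δ' ] NonEL D × Δ ↭ D ∷ Δ' × weightΔ Δ ≡ weight D + weightΔ Δ'

weight-EL : ∀ {φ} → IsEL φ → weight φ ≡ 0
weight-EL el-eq = refl
weight-EL el-neq = refl
weight-EL el-∃ = refl
weight-EL el-⊥ = refl

EL-or-NonEL-∷ : ∀ {φ Δ} → IsEL φ → EL Δ ⊎ NonELSplit Δ → EL (φ ∷ Δ) ⊎ NonELSplit (φ ∷ Δ)
EL-or-NonEL-∷ el (inj₁ els) = inj₁ (el ∷ els)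
EL-or-NonEL-∷ {φ} {Δ} el (inj₂ (D , Δ' , nd , r , w)) =
  inj₂ (D , φ ∷ Δ' , nd , ↭-trans (prep φ r) (swap φ D ↭-refl) , w′)
  where
  w′ : weight φ + weightΔ Δ ≡ weight D + (weight φ + weightΔ Δ')
  w′ rewrite weight-EL el = w

EL-or-NonEL : ∀ Δ → EL Δ ⊎ NonELSplit Δ
EL-or-NonEL [] = inj₁ []
EL-or-NonEL (⊤F ∷ Δ) = inj₂ (_ , Δ , ne⊤ , ↭-refl , refl)
EL-or-NonEL ((A ∧F B) ∷ Δ) = inj₂ (_ , Δ , ne∧ , ↭-refl , refl)
EL-or-NonEL ((A ∨F B) ∷ Δ) = inj₂ (_ , Δ , ne∨ , ↭-refl , refl)
EL-or-NonEL (∀F b φ ∷ Δ) = inj₂ (_ , Δ , ne∀ , ↭-refl , refl)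
EL-or-NonEL ((a =U b) ∷ Δ) = EL-or-NonEL-∷ el-eq (EL-or-NonEL Δ)
EL-or-NonEL ((a ≠U b) ∷ Δ) = EL-or-NonEL-∷ el-neq (EL-or-NonEL Δ)
EL-or-NonEL (⊥F ∷ Δ) = EL-or-NonEL-∷ el-⊥ (EL-or-NonEL Δ)
EL-or-NonEL (∃F b φ ∷ Δ) = EL-or-NonEL-∷ el-∃ (EL-or-NonEL Δ)

-- R is inverted and Q rebuilt along the non-EL connectives until the succedent is EL;
-- the induction is on its weight.
record NonELInduction : Set₁ where
  field
    R Q : List Mem → List (Fm []) → Set
    avoid : List Var
    leaf : ∀ {Θ Δ} → EL Δ → R Θ Δ → Q Θ Δ
    R-↭ : ∀ {Θ Δ Δ'} → Δ ↭ Δ' → R Θ Δ → R Θ Δ'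
    Q-↭ : ∀ {Θ Δ Δ'} → Δ ↭ Δ' → Q Θ Δ → Q Θ Δ'
    Q-⊤ : ∀ {Θ Δ} → Q Θ (⊤F ∷ Δ)
    R-∧ : ∀ {Θ A B Δ} → R Θ ((A ∧F B) ∷ Δ) → R Θ (A ∷ Δ) × R Θ (B ∷ Δ)
    Q-∧ : ∀ {Θ A B Δ} → Q Θ (A ∷ Δ) → Q Θ (B ∷ Δ) → Q Θ ((A ∧F B) ∷ Δ)
    R-∨ : ∀ {Θ A B Δ} → R Θ ((A ∨F B) ∷ Δ) → R Θ (A ∷ B ∷ Δ)
    Q-∨ : ∀ {Θ A B Δ} → Q Θ (A ∷ B ∷ Δ) → Q Θ ((A ∨F B) ∷ Δ)
    R-∀ : ∀ {Θ T} {b : Tm [] (SetT T)} {φ Δ} z → (z , T) ∉ avoid ++ fvsΘ Θ ++ fvsΔ (∀F b φ ∷ Δ) →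
          R Θ (∀F b φ ∷ Δ) → R ((fv z ∈M b) ∷ Θ) (inst φ (fv z) ∷ Δ)
    Q-∀ : ∀ {Θ T} {b : Tm [] (SetT T)} {φ Δ} z → (z , T) ∉ avoid ++ fvsΘ Θ ++ fvsΔ (∀F b φ ∷ Δ) →
          Q ((fv z ∈M b) ∷ Θ) (inst φ (fv z) ∷ Δ) → Q Θ (∀F b φ ∷ Δ)

  private
    bounded : ∀ k {Θ Δ} → weightΔ Δ ≤ k → R Θ Δ → Q Θ Δ
    step : ∀ k {Θ D Δ} → NonEL D → weight D + weightΔ Δ ≤ k → R Θ (D ∷ Δ) → Q Θ (D ∷ Δ)

    bounded k {Δ = Δ} w≤k rd with EL-or-NonEL Δ
    ... | inj₁ el = leaf el rd
    ... | inj₂ (D , Δ' , nd , r , w≡) = Q-↭ (↭-sym r) (step k nd (subst (_≤ k) w≡ w≤k) (R-↭ r rd))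

    step k ne⊤ w≤k rd = Q-⊤
    step (suc k) {Δ = Δ} (ne∧ {A} {B}) (s≤s w≤k) rd =
      Q-∧ (bounded k (≤-trans (+-monoˡ-≤ (weightΔ Δ) (m≤m+n (weight A) (weight B))) w≤k) (proj₁ (R-∧ rd)))
          (bounded k (≤-trans (+-monoˡ-≤ (weightΔ Δ) (m≤n+m (weight B) (weight A))) w≤k) (proj₂ (R-∧ rd)))
    step (suc k) {Δ = Δ} (ne∨ {A} {B}) (s≤s w≤k) rd =
      Q-∨ (bounded k (subst (_≤ k) (+-assoc (weight A) (weight B) (weightΔ Δ)) w≤k) (R-∨ rd))
    step (suc k) {Θ} {Δ = Δ} (ne∀ {T} {b} {φ}) (s≤s w≤k) rd =
      Q-∀ z (fresh-∉ L)
        (bounded k (subst (_≤ k) (cong (_+ weightΔ Δ) (sym (weight-subFm (sub₀ (fv z)) φ))) w≤k) (R-∀ z (fresh-∉ L) rd))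
      where
      L = avoid ++ fvsΘ Θ ++ fvsΔ (∀F b φ ∷ Δ)
      z = fresh L

  nonEL-induction : ∀ {Θ Δ} → R Θ Δ → Q Θ Δ
  nonEL-induction {Δ = Δ} = bounded (weightΔ Δ) ≤-refl

-- Admissibility of the rules with EL side conditions

module Substituted {S} (x : ℕ) (s : Tm [] S) (avoid : List Var) (avoid-⊇ : (x , S) ∷ fvsTm s ⊆ avoid) where

  fvs-single : ∀ m S′ {v} → v ∈ fvsTm (single s x {S′} m) → v ∈ fvsTm s ⊎ v ≡ (m , S′)
  fvs-single m S′ i with (m , S′) ≟V (x , S)
  ... | yes refl = inj₁ (subst (λ a → _ ∈ fvsTm a) (single-hit s x) i)
  ... | no m≢x with subst (λ a → _ ∈ fvsTm a) (single-miss s x m m≢x) i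
  ...   | here e = inj₂ e

  FreshIn-[/] : ∀ {v Θ Δ} → v ∉ avoid ++ fvsΘ Θ ++ fvsΔ Δ → FreshIn v (Θ [ s / x ]Θ) (Δ [ s / x ]Δ)
  FreshIn-[/] {Θ = Θ} {Δ} fr i with ImageFv-++ (single s x) (fvsΘ (Θ [ s / x ]Θ)) (fvsΘ-fsub⁻ _ Θ) (fvsΔ-fsub⁻ _ Δ) i
  ... | m , S′ , k , l with fvs-single m S′ l
  ...   | inj₁ v∈s = fr (∈-++⁺ˡ (avoid-⊇ (there v∈s)))
  ...   | inj₂ refl = fr (∈-++⁺ʳ avoid k)

  module _ {T} {Θ : List Mem} {b : Tm [] (SetT T)} {φ : Fm (T ∷ [])} {Δ : List (Fm [])} (z : ℕ)
           (fr : (z , T) ∉ avoid ++ fvsΘ Θ ++ fvsΔ (∀F b φ ∷ Δ)) where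

    private
      z[/] : fsubTm {[]} (single s x) (fv {T = T} z) ≡ fv z
      z[/] = cong wk (single-miss s x z (λ e → fr (∈-++⁺ˡ (avoid-⊇ (here e)))))

      premise-[/] : ((fv z ∈M b) ∷ Θ) [ s / x ]Θ ≡ (fv z ∈M fsubTm (single s x) b) ∷ Θ [ s / x ]Θ
                  × (inst φ (fv z) ∷ Δ) [ s / x ]Δ ≡ inst (fsubFm (single s x) φ) (fv z) ∷ Δ [ s / x ]Δ
      premise-[/] = cong (λ a → (a ∈M _) ∷ _) z[/]
                  , cong (_∷ _) (trans (fsubFm-inst (single s x) φ (fv z)) (cong (inst _) z[/]))

    ⊢E-∀-inv-[/] : Θ [ s / x ]Θ ⊢E (∀F b φ ∷ Δ) [ s / x ]Δ →
                   ((fv z ∈M b) ∷ Θ) [ s / x ]Θ ⊢E (inst φ (fv z) ∷ Δ) [ s / x ]Δ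
    ⊢E-∀-inv-[/] d = subst₂ _⊢E_ (sym (proj₁ premise-[/])) (sym (proj₂ premise-[/]))
                       (⊢E-∀-inv d ↭-refl z (FreshIn-[/] {Θ = Θ} {∀F b φ ∷ Δ} fr))

    allE-[/] : ((fv z ∈M b) ∷ Θ) [ s / x ]Θ ⊢E (inst φ (fv z) ∷ Δ) [ s / x ]Δ →
               Θ [ s / x ]Θ ⊢E (∀F b φ ∷ Δ) [ s / x ]Δ
    allE-[/] d = allE z (FreshIn-[/] {Θ = Θ} {∀F b φ ∷ Δ} fr) (subst₂ _⊢E_ (proj₁ premise-[/]) (proj₂ premise-[/]) d)

[/]-rule-admissible : ∀ {S} x (s s' : Tm [] S) → SubstRule x s s' →
                      ∀ {Θ Δ} → Θ [ s / x ]Θ ⊢E Δ [ s / x ]Δ → Θ [ s' / x ]Θ ⊢E Δ [ s' / x ]Δ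
[/]-rule-admissible {S} x s s' rule = NonELInduction.nonEL-induction (record
  { R = λ Θ Δ → Θ [ s / x ]Θ ⊢E Δ [ s / x ]Δ
  ; Q = λ Θ Δ → Θ [ s' / x ]Θ ⊢E Δ [ s' / x ]Δ
  ; avoid = avoid
  ; leaf = rule
  ; R-↭ = λ r → ⊢E-↭ (PermP.map⁺ _ r)
  ; Q-↭ = λ r → ⊢E-↭ (PermP.map⁺ _ r)
  ; Q-⊤ = axTopE
  ; R-∧ = λ d → ⊢E-∧-inv d ↭-refl
  ; Q-∧ = andE
  ; R-∨ = λ d → ⊢E-∨-inv d ↭-refl
  ; Q-∨ = orE
  ; R-∀ = λ {Θ} {_} {b} {φ} {Δ} → Substituted.⊢E-∀-inv-[/] x s avoid s⊆ {Θ = Θ} {b} {φ} {Δ}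
  ; Q-∀ = λ {Θ} {_} {b} {φ} {Δ} → Substituted.allE-[/] x s' avoid s'⊆ {Θ = Θ} {b} {φ} {Δ}
  })
  where
  avoid = (x , S) ∷ fvsTm s ++ fvsTm s'
  s⊆ : (x , S) ∷ fvsTm s ⊆ avoid
  s⊆ = ∷⁺ʳ _ (xs⊆xs++ys _ _)
  s'⊆ : (x , S) ∷ fvsTm s' ⊆ avoid
  s'⊆ = ∷⁺ʳ _ (xs⊆ys++xs _ (fvsTm s))

η-admissible : ∀ {Θ Δ A B} (x x₁ x₂ : ℕ) →
               FreshIn (x₁ , A) Θ Δ → FreshIn (x₂ , B) Θ Δ → (x₁ , A) ≢ (x₂ , B) →
               Θ [ ⟨ fv {T = A} x₁ , fv {T = B} x₂ ⟩ / x ]Θ ⊢E Δ [ ⟨ fv {T = A} x₁ , fv {T = B} x₂ ⟩ / x ]Δ →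
               Θ ⊢E Δ
-- Q carries the freshness of x₁ and x₂ that the η rule needs at the leaves
η-admissible {A = A} {B} x x₁ x₂ x₁∉ x₂∉ x₁≢x₂ d = NonELInduction.nonEL-induction (record
  { R = λ Θ Δ → Θ [ p / x ]Θ ⊢E Δ [ p / x ]Δ
  ; Q = λ Θ Δ → FreshIn (x₁ , A) Θ Δ → FreshIn (x₂ , B) Θ Δ → Θ ⊢E Δ
  ; avoid = avoid
  ; leaf = λ el d g₁ g₂ → etaE x x₁ x₂ el g₁ g₂ x₁≢x₂ d
  ; R-↭ = λ r → ⊢E-↭ (PermP.map⁺ _ r)
  ; Q-↭ = λ {Θ} r q g₁ g₂ → ⊢E-↭ r (q (FreshIn-↭ Θ r g₁) (FreshIn-↭ Θ r g₂))
  ; Q-⊤ = λ _ _ → axTopE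
  ; R-∧ = λ d → ⊢E-∧-inv d ↭-refl
  ; Q-∧ = λ {Θ} {A'} {B'} {Δ} q₁ q₂ g₁ g₂ →
      andE (q₁ (FreshIn-∧ˡ Θ A' B' Δ g₁) (FreshIn-∧ˡ Θ A' B' Δ g₂))
           (q₂ (FreshIn-∧ʳ Θ A' B' Δ g₁) (FreshIn-∧ʳ Θ A' B' Δ g₂))
  ; R-∨ = λ d → ⊢E-∨-inv d ↭-refl
  ; Q-∨ = λ {Θ} {A'} {B'} {Δ} q g₁ g₂ → orE (q (FreshIn-∨ Θ A' B' Δ g₁) (FreshIn-∨ Θ A' B' Δ g₂))
  ; R-∀ = λ {Θ} {_} {b} {φ} {Δ} → Substituted.⊢E-∀-inv-[/] x p avoid ⊆-refl {Θ = Θ} {b} {φ} {Δ}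
  ; Q-∀ = λ {Θ} {_} {b} {φ} {Δ} z fr q g₁ g₂ →
      allE z (λ i → fr (∈-++⁺ʳ avoid i))
        (q (FreshIn-∀-premise z Θ b φ Δ (λ { refl → fr (there (here refl)) }) g₁)
           (FreshIn-∀-premise z Θ b φ Δ (λ { refl → fr (there (there (here refl))) }) g₂))
  }) d x₁∉ x₂∉
  where
  p = ⟨ fv {T = A} x₁ , fv {T = B} x₂ ⟩
  avoid = (x , A ⊗ B) ∷ fvsTm p

fvsΘ-++ : ∀ (Θ₀ Θ : List Mem) → fvsΘ (Θ₀ ++ Θ) ≡ fvsΘ Θ₀ ++ fvsΘ Θ
fvsΘ-++ [] Θ = refl
fvsΘ-++ ((a ∈M b) ∷ Θ₀) Θ = begin
  fvsTm a ++ fvsTm b ++ fvsΘ (Θ₀ ++ Θ)         ≡⟨ cong (λ L → fvsTm a ++ fvsTm b ++ L) (fvsΘ-++ Θ₀ Θ) ⟩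
  fvsTm a ++ fvsTm b ++ fvsΘ Θ₀ ++ fvsΘ Θ      ≡⟨ cong (fvsTm a ++_) (sym (++-assoc (fvsTm b) _ _)) ⟩
  fvsTm a ++ (fvsTm b ++ fvsΘ Θ₀) ++ fvsΘ Θ    ≡⟨ sym (++-assoc (fvsTm a) _ _) ⟩
  (fvsTm a ++ fvsTm b ++ fvsΘ Θ₀) ++ fvsΘ Θ    ∎
  where open ≡-Reasoning

⊢E-unshift : ∀ {Θ P zs} ws → Θ ⊢E P ∷ ws ++ zs → Θ ⊢E ws ++ P ∷ zs
⊢E-unshift ws = ⊢E-↭ (↭-sym (PermP.shift _ ws _))

module _ (Θ₀ : List Mem) (P C : List (Fm []))
         (rule : ∀ {Θ Δ} → EL Δ → Θ₀ ++ Θ ⊢E P ++ Δ → Θ₀ ++ Θ ⊢E C ++ Δ) where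

  private
    avoid : List Var
    avoid = fvsΘ Θ₀ ++ fvsΔ P ++ fvsΔ C

    FreshIn-context : ∀ K → fvsΔ K ⊆ avoid → ∀ {v Θ D Δ} → v ∉ avoid ++ fvsΘ Θ ++ fvsΔ (D ∷ Δ) →
                      FreshIn v (Θ₀ ++ Θ) (D ∷ K ++ Δ)
    FreshIn-context K K⊆ {Θ = Θ} {D} {Δ} fr = fr ∘ ++-⊆ Θ₀Θ⊆ (++-⊆ D⊆ (KΔ⊆ ∘ subst (_ ∈_) (fvsΔ-++ K Δ)))
      where
      L = avoid ++ fvsΘ Θ ++ fvsΔ (D ∷ Δ)
      Θ₀Θ⊆ : fvsΘ (Θ₀ ++ Θ) ⊆ L
      Θ₀Θ⊆ i with ∈-++⁻ (fvsΘ Θ₀) (subst (_ ∈_) (fvsΘ-++ Θ₀ Θ) i)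
      ... | inj₁ j = ∈-++⁺ˡ (∈-++⁺ˡ j)
      ... | inj₂ j = ∈-++⁺ʳ avoid (∈-++⁺ˡ j)
      D⊆ : fvsFm D ⊆ L
      D⊆ = ∈-++⁺ʳ avoid ∘ ∈-++⁺ʳ (fvsΘ Θ) ∘ ∈-++⁺ˡ
      KΔ⊆ : fvsΔ K ++ fvsΔ Δ ⊆ L
      KΔ⊆ = ++-⊆ (∈-++⁺ˡ ∘ K⊆) (∈-++⁺ʳ avoid ∘ ∈-++⁺ʳ (fvsΘ Θ) ∘ ∈-++⁺ʳ (fvsFm D))

  context-rule-admissible : ∀ {Θ Δ} → Θ₀ ++ Θ ⊢E P ++ Δ → Θ₀ ++ Θ ⊢E C ++ Δ
  context-rule-admissible = NonELInduction.nonEL-induction (record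
    { R = λ Θ Δ → Θ₀ ++ Θ ⊢E P ++ Δ
    ; Q = λ Θ Δ → Θ₀ ++ Θ ⊢E C ++ Δ
    ; avoid = avoid
    ; leaf = rule
    ; R-↭ = λ r → ⊢E-↭ (PermP.++⁺ˡ P r)
    ; Q-↭ = λ r → ⊢E-↭ (PermP.++⁺ˡ C r)
    ; Q-⊤ = ⊢E-unshift C axTopE
    ; R-∧ = λ d → let dA , dB = ⊢E-∧-inv d (PermP.shift _ P _) in ⊢E-unshift P dA , ⊢E-unshift P dB
    ; Q-∧ = λ q₁ q₂ → ⊢E-unshift C (andE (⊢E-shift C q₁) (⊢E-shift C q₂))
    ; R-∨ = λ d → ⊢E-↭ (PermP.shifts (_ ∷ _ ∷ []) P) (⊢E-∨-inv d (PermP.shift _ P _))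
    ; Q-∨ = λ q → ⊢E-unshift C (orE (⊢E-↭ (PermP.shifts C (_ ∷ _ ∷ [])) q))
    ; R-∀ = λ {_} {_} {b} {φ} z fr d →
        permE (↭-sym (PermP.shift _ Θ₀ _)) (↭-sym (PermP.shift _ P _))
          (⊢E-∀-inv d (PermP.shift _ P _) z (FreshIn-context P P⊆ {D = ∀F b φ} fr))
    ; Q-∀ = λ {_} {_} {b} {φ} z fr q →
        ⊢E-unshift C (allE z (FreshIn-context C C⊆ {D = ∀F b φ} fr) (permE (PermP.shift _ Θ₀ _) (PermP.shift _ C _) q))
    })
    where
    P⊆ : fvsΔ P ⊆ avoid
    P⊆ = ∈-++⁺ʳ (fvsΘ Θ₀) ∘ ∈-++⁺ˡ
    C⊆ : fvsΔ C ⊆ avoid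
    C⊆ = ∈-++⁺ʳ (fvsΘ Θ₀) ∘ ∈-++⁺ʳ (fvsΔ P)

-- From the base calculus to the EL-normalized calculus

data TupleMem : Mem → Set where
  tuple∈ : ∀ {T} {a : Tm [] T} {b : Tm [] (SetT T)} → IsTuple a → TupleMem (a ∈M b)

TupleMems-fsub : ∀ {ρ : FSub} → TupSub ρ → ∀ {Θ} → All TupleMem Θ → All TupleMem (fsubΘ ρ Θ)
TupleMems-fsub tρ = AllP.map⁺ ∘ All.map (λ { (tuple∈ a) → tuple∈ (IsTuple-fsub tρ a) })

-- a non-tuple s cannot have been substituted into a tuple-term
IsTuple-resubst : ∀ {A T} {s : Tm [] A} (s' : Tm [] A) x (a : Tm [] T) → ¬ IsTuple s →
                  IsTuple (fsubTm (single s x) a) → IsTuple (fsubTm (single s' x) a)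
IsTuple-resubst {A} {T} {s} s' x (fv m) s-not-tup a-tup with (m , T) ≟V (x , A)
... | yes refl = ⊥-elim (s-not-tup (subst IsTuple (trans (cong wk (single-hit s x)) (wk-id s)) a-tup))
... | no m≢x = subst IsTuple (cong wk (trans (single-miss s x m m≢x) (sym (single-miss s' x m m≢x)))) a-tup
IsTuple-resubst s' x ⟨ a₁ , a₂ ⟩ s-not-tup (tup-pair p q) =
  tup-pair (IsTuple-resubst s' x a₁ s-not-tup p) (IsTuple-resubst s' x a₂ s-not-tup q)

TupleMems-resubst : ∀ {A} {s : Tm [] A} (s' : Tm [] A) x (Θ : List Mem) → ¬ IsTuple s →
                    All TupleMem (Θ [ s / x ]Θ) → All TupleMem (Θ [ s' / x ]Θ)
TupleMems-resubst s' x [] s-not-tup [] = []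
TupleMems-resubst s' x ((a ∈M b) ∷ Θ) s-not-tup (tuple∈ a-tup ∷ tΘ) =
  tuple∈ (IsTuple-resubst s' x a s-not-tup a-tup) ∷ TupleMems-resubst s' x Θ s-not-tup tΘ

⊢B⇒⊢E : ∀ {Θ Δ} → All TupleMem Θ → Θ ⊢B Δ → Θ ⊢E Δ
⊢B⇒⊢E tΘ (permB p q d) = permE p q (⊢B⇒⊢E (PermP.All-resp-↭ (↭-sym p) tΘ) d)
⊢B⇒⊢E tΘ (axEqB n) = axEqE n
⊢B⇒⊢E tΘ axTopB = axTopE
⊢B⇒⊢E tΘ (neqB {t = t} {u} {α} n at d) =
  context-rule-admissible [] ((t ≠U u) ∷ (α [ u / n ]F) ∷ (α [ t / n ]F) ∷ []) ((t ≠U u) ∷ (α [ t / n ]F) ∷ [])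
    (neqE n at) (⊢B⇒⊢E tΘ d)
⊢B⇒⊢E tΘ (andB d₁ d₂) = andE (⊢B⇒⊢E tΘ d₁) (⊢B⇒⊢E tΘ d₂)
⊢B⇒⊢E tΘ (orB d) = orE (⊢B⇒⊢E tΘ d)
⊢B⇒⊢E tΘ (allB y fr d) = allE y fr (⊢B⇒⊢E (tuple∈ tup-var ∷ tΘ) d)
⊢B⇒⊢E tΘ@(tuple∈ t-tup ∷ _) (exB {b = b} {φ} t d) =
  context-rule-admissible ((t ∈M b) ∷ []) (inst φ t ∷ ∃F b φ ∷ []) (∃F b φ ∷ []) (exE t t-tup) (⊢B⇒⊢E tΘ d)
⊢B⇒⊢E {Θ} tΘ (etaB x x₁ x₂ x₁∉ x₂∉ x₁≢x₂ d) =
  η-admissible x x₁ x₂ x₁∉ x₂∉ x₁≢x₂ (⊢B⇒⊢E (TupleMems-fsub (TupSub-single (tup-pair tup-var tup-var) x) tΘ) d)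
⊢B⇒⊢E tΘ (beta₁B {Θ} x t₁ t₂ d) =
  [/]-rule-admissible x t₁ (π₁ ⟨ t₁ , t₂ ⟩) (beta₁E x t₁ t₂) (⊢B⇒⊢E (TupleMems-resubst t₁ x Θ (λ ()) tΘ) d)
⊢B⇒⊢E tΘ (beta₂B {Θ} x t₁ t₂ d) =
  [/]-rule-admissible x t₂ (π₂ ⟨ t₁ , t₂ ⟩) (beta₂E x t₁ t₂) (⊢B⇒⊢E (TupleMems-resubst t₂ x Θ (λ ()) tΘ) d)

theoremF5 : (φ : Fm []) → ProvableB φ → ProvableE φ
theoremF5 φ = ⊢B⇒⊢E []
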